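{- In the setting below, there exists $w\in W^P$ of length $l(w)=\frac{\dim U_P}2$ such that $\tilde\mu+\boldsymbol\rho_N=w(\lambda+\boldsymbol\rho_N)$ for some dominant weight $\lambda\in\mathbb Z^N$ if and only if $$-\tilde p(\tilde\mu)+1\ \le\ \tilde a(\tilde\mu)\ \le\ \tilde p(\tilde\mu)-1.$$
   Context: Let $n$ be even, $n'\ge1$, $N=n+n'$. Let $\mu=(b_1\ge\dots\ge b_n)\in\mathbb Z^n$ with $a_i:=b_i-b_{i+1}+1$ satisfying $a_{n-i}=a_i$, $d=(b_1+\dots+b_n)/n$, and $\beta_j=b_j+\frac{n+1}2-j-d$ (so $\beta_{n+1-j}=-\beta_j$). Similarly $\mu'=(b'_1\ge\dots\ge b'_{n'})\in\mathbb Z^{n'}$ with $a'_{n'-i}=a'_i$, $d'$, $\beta'_j$. Assume $\beta_i+\beta'_j\ne0$ for all $(i,j)\in S=\{1,\dots,n\}\times\{1,\dots,n'\}$. Put $\tilde p(\tilde\mu)=\min\{\beta_i+\beta'_j>0:(i,j)\in S\}$, $\tilde\mu=(\mu,\mu')\in\mathbb Z^N$, $\tilde a(\tilde\mu)=d-d'+\frac N2$, $\boldsymbol\rho_N=(\frac{N-1}2,\dots,\frac{1-N}2)$. $W=S_N$ acts by $(wx)_i=x_{w^{ -1}(i)}$, $l(w)$ the number of inversions; $P$ the standard parabolic of type $(n,n')$, $\dim U_P=nn'$, $W^P=\{w:w^{ -1}(i)<w^{ -1}(i+1)\ \text{for}\ i\ne n\}$; dominant means non-increasing coordinates. -}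

module Defs where

open import Data.Nat as ℕ using (ℕ; zero; suc; NonZero)
open import Data.Integer as ℤ using (ℤ; +_)
open import Data.Rational as ℚ using (ℚ; 0ℚ; 1ℚ; _/_)
open import Data.Rational.Properties as ℚP using ()
open import Data.Fin as Fin using (Fin; toℕ)
open import Data.Fin.Properties as FinP using ()
open import Data.Fin.Permutation using (Permutation′; _⟨$⟩ʳ_; _⟨$⟩ˡ_)
open import Data.List as List using (List; []; _∷_; allFin; cartesianProduct; filter; length; map; foldr)
import Data.Sum
import Relation.Nullary
open import Data.Product using (_×_; _,_; proj₁; proj₂)
open import Relation.Nullary.Decidable using (_×-dec_)
open import Relation.Binary.PropositionalEquality using (_≡_; _≢_)

ℤ→ℚ : ℤ → ℚ
ℤ→ℚ z = z / 1

Dominant : ∀ {m} → (Fin m → ℤ) → Set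
Dominant {m} v = ∀ (i j : Fin m) → i Fin.≤ j → v j ℤ.≤ v i

-- 1-based access b_i (value 0 outside 1..m; only used in range)
get : ∀ {m} → (Fin m → ℤ) → ℕ → ℤ
get {m} v zero = ℤ.0ℤ
get {m} v (suc k) with k ℕ.<? m
... | Relation.Nullary.yes p = v (Fin.fromℕ< p)
... | Relation.Nullary.no _ = ℤ.0ℤ

aCoef : ∀ {m} → (Fin m → ℤ) → ℕ → ℤ
aCoef v i = get v i ℤ.- get v (suc i) ℤ.+ ℤ.1ℤ

Symmetric : ∀ {m} → (Fin m → ℤ) → Set
Symmetric {m} v = ∀ (i : ℕ) → 1 ℕ.≤ i → i ℕ.< m → aCoef v (m ℕ.∸ i) ≡ aCoef v i

sumℤ : ∀ {m} → (Fin m → ℤ) → ℤ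
sumℤ {m} v = foldr ℤ._+_ ℤ.0ℤ (map v (allFin m))

dval : ∀ {m} .{{_ : NonZero m}} → (Fin m → ℤ) → ℚ
dval {m} v = sumℤ v / m

-- β_j = b_j + (m+1)/2 - j - d   (j = toℕ k + 1 for k : Fin m)
β : ∀ {m} .{{_ : NonZero m}} → (Fin m → ℤ) → Fin m → ℚ
β {m} v k = ℤ→ℚ (v k) ℚ.+ (+ (suc m) / 2) ℚ.- (+ (suc (toℕ k)) / 1) ℚ.- dval v

-- minimum of a list of rationals (default 0 for the empty list)
minimumℚ : List ℚ → ℚ
minimumℚ [] = 0ℚ
minimumℚ (x ∷ xs) = foldr ℚ._⊓_ x xs

pTilde : ∀ {n n'} .{{_ : NonZero n}} .{{_ : NonZero n'}} →
         (Fin n → ℤ) → (Fin n' → ℤ) → ℚ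
pTilde {n} {n'} μ μ' =
  minimumℚ (filter (λ q → 0ℚ ℚP.<? q)
    (map (λ ij → β μ (proj₁ ij) ℚ.+ β μ' (proj₂ ij))
         (cartesianProduct (allFin n) (allFin n'))))

aTilde : ∀ {n n'} .{{_ : NonZero n}} .{{_ : NonZero n'}} →
         (Fin n → ℤ) → (Fin n' → ℤ) → ℚ
aTilde {n} {n'} μ μ' = dval μ ℚ.- dval μ' ℚ.+ (+ (n ℕ.+ n') / 2)

concatW : ∀ {n n'} → (Fin n → ℤ) → (Fin n' → ℤ) → Fin (n ℕ.+ n') → ℤ
concatW {n} μ μ' i with Fin.splitAt n i
... | Data.Sum.inj₁ k = μ k
... | Data.Sum.inj₂ k = μ' k

-- ρ_N, 0-based coordinate k: (N+1)/2 - (k+1) = (N-1)/2 - k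
ρ : (N : ℕ) → Fin N → ℚ
ρ N k = (+ (suc N) / 2) ℚ.- (+ (suc (toℕ k)) / 1)

act : ∀ {N} → Permutation′ N → (Fin N → ℚ) → Fin N → ℚ
act w x i = x (w ⟨$⟩ˡ i)

len : ∀ {N} → Permutation′ N → ℕ
len {N} w = length (filter
  (λ ij → (proj₁ ij Fin.<? proj₂ ij) ×-dec ((w ⟨$⟩ʳ proj₂ ij) Fin.<? (w ⟨$⟩ʳ proj₁ ij)))
  (cartesianProduct (allFin N) (allFin N)))

-- W^P for P of type (n, n'): w⁻¹(i) < w⁻¹(i+1) for all 1 ≤ i ≤ N-1 with i ≠ n
-- (1-based i = suc k, i.e. 0-based positions k and suc k)
InWP : ∀ (n : ℕ) {n'} → Permutation′ (n ℕ.+ n') → Set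
InWP n {n'} w = ∀ (k : ℕ) (p : suc k ℕ.< n ℕ.+ n') → suc k ≢ n →
  (w ⟨$⟩ˡ Fin.fromℕ< (ℕP.<-trans (ℕP.n<1+n k) p)) Fin.< (w ⟨$⟩ˡ Fin.fromℕ< p)
  where import Data.Nat.Properties as ℕP

{-# OPTIONS --safe #-}
module Submission where

-- Shift μ̃ + ρ by a constant to the integer vector X, Xₖ = μ̃ₖ − k. The equation
-- μ̃ + ρ = w(λ + ρ) with λ dominant says that X = Y ∘ w⁻¹ for a strictly decreasing Y.
-- So such w and λ exist iff the coordinates of X are distinct, w being then the
-- permutation sorting X; it lies in W^P because X decreases on each block, and its
-- length counts the pairs (i, j) with Xᵢ < X_{n+j}, i.e. with e_ij := Xᵢ − X_{N+1−j} < 0.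
-- The symmetry of the aᵢ gives e_ij + e_{n+1−i,n′+1−j} = A with ã = A/2 and
-- βᵢ + β′ⱼ = e_ij − A/2. Since no e_ij equals A/2, this involution shows that exactly
-- half of the pairs lie below A/2. Hence l(w) = nn′/2 with distinct coordinates holds
-- iff the sign of each e_ij matches its side of A/2, i.e. iff the least e_ij above A/2,
-- which is p̃ + A/2, exceeds both 0 and A: this is the window −p̃ + 1 ≤ ã ≤ p̃ − 1.

open import Defs
open import Data.Nat as ℕ using (ℕ; zero; suc; z≤n; s≤s)
import Data.Nat.Properties as ℕP
open import Data.Integer as ℤ using (ℤ; +_)
import Data.Integer.Properties as ℤP
open import Data.Integer.Tactic.RingSolver using (solve-∀)
open import Data.Rational as ℚ using (ℚ; 0ℚ; 1ℚ; toℚᵘ)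
import Data.Rational.Properties as ℚP
open import Data.Rational.Unnormalised as ℚᵘ using (mkℚᵘ; *≡*; *≤*)
import Data.Rational.Unnormalised.Properties as ℚᵘP
open import Data.Fin as Fin using (Fin; toℕ; fromℕ<; opposite; _↑ˡ_; _↑ʳ_)
import Data.Fin.Properties as FinP
open import Data.Fin.Permutation as Perm using (Permutation′; _⟨$⟩ʳ_; _⟨$⟩ˡ_; permutation)
open import Data.Bool using (true; false; if_then_else_)
open import Data.List as List using (List; []; _∷_; allFin; cartesianProduct; filter; length; map; tabulate)
import Data.List.Properties as ListP
open import Data.Product using (_×_; _,_; proj₁; proj₂; Σ; ∃)
open import Data.Sum using (_⊎_; inj₁; inj₂)
open import Data.List.Membership.Propositional using (_∈_)
import Data.List.Membership.Propositional.Properties as ∈P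
open import Data.List.Relation.Unary.Any using (here; there)
open import Relation.Nullary using (Dec; yes; no; does; ¬_; contradiction)
open import Relation.Nullary.Decidable using (_×-dec_)
open import Relation.Unary using (Pred; Decidable)
open import Relation.Binary using (tri<; tri≈; tri>)
open import Function.Definitions using (Injective)
import Algebra.Properties.CommutativeMonoid.Sum as CommutativeMonoidSum
open import Algebra.Bundles using (AbelianGroup)
open import Algebra.Properties.Group (AbelianGroup.group ℤP.+-0-abelianGroup) using () renaming (∙-cancelʳ to +-cancelʳ)
open import Function using (_∘_; id)
open import Function.Bundles using (_⇔_; mk⇔; Equivalence)
open import Function.Properties.Equivalence using (⇔-setoid)
open import Data.Product.Function.NonDependent.Propositional using (_×-⇔_)
open import Relation.Binary.PropositionalEquality
open import Data.Nat using (NonZero; _+_; _*_)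
open import Data.Nat.Divisibility using (_∣_)
open import Data.Rational using (_≤_; -_; _-_)
open import Level using (Level; 0ℓ)

-- Halves of integers

half : ℤ → ℚ
half z = z ℚ./ 2

toℚᵘ-half : ∀ z → toℚᵘ (half z) ℚᵘ.≃ mkℚᵘ z 1
toℚᵘ-half z = ℚP.toℚᵘ-fromℚᵘ (mkℚᵘ z 1)

ℤ→ℚ≡half : ∀ z → ℤ→ℚ z ≡ half (z ℤ.* + 2)
ℤ→ℚ≡half z = ℚP.fromℚᵘ-cong {mkℚᵘ z 0} {mkℚᵘ (z ℤ.* + 2) 1} (*≡* (sym (ℤP.*-identityʳ (z ℤ.* + 2))))

/≡half : ∀ z c k → z ℤ.* + 2 ≡ c ℤ.* + suc k → z ℚ./ suc k ≡ half c
/≡half z c k eq = ℚP.fromℚᵘ-cong {mkℚᵘ z k} {mkℚᵘ c 1} (*≡* eq)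

half-+ : ∀ a b → half (a ℤ.+ b) ≡ half a ℚ.+ half b
half-+ a b = ℚP.toℚᵘ-injective (begin
  toℚᵘ (half (a ℤ.+ b))              ≈⟨ toℚᵘ-half (a ℤ.+ b) ⟩
  mkℚᵘ (a ℤ.+ b) 1                   ≈⟨ *≡* (lemma a b) ⟩
  mkℚᵘ a 1 ℚᵘ.+ mkℚᵘ b 1             ≈⟨ ℚᵘP.+-cong (toℚᵘ-half a) (toℚᵘ-half b) ⟨
  toℚᵘ (half a) ℚᵘ.+ toℚᵘ (half b)   ≈⟨ ℚP.toℚᵘ-homo-+ (half a) (half b) ⟨
  toℚᵘ (half a ℚ.+ half b)           ∎)
  where
  open ℚᵘP.≃-Reasoning
  lemma : ∀ a b → (a ℤ.+ b) ℤ.* + 4 ≡ (a ℤ.* + 2 ℤ.+ b ℤ.* + 2) ℤ.* + 2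
  lemma = solve-∀

half-neg : ∀ a → half (ℤ.- a) ≡ ℚ.- half a
half-neg a = ℚP.toℚᵘ-injective (begin
  toℚᵘ (half (ℤ.- a))   ≈⟨ toℚᵘ-half (ℤ.- a) ⟩
  ℚᵘ.- mkℚᵘ a 1         ≈⟨ ℚᵘP.-‿cong (toℚᵘ-half a) ⟨
  ℚᵘ.- toℚᵘ (half a)    ≈⟨ ℚP.toℚᵘ-homo‿- (half a) ⟨
  toℚᵘ (ℚ.- half a)     ∎)
  where open ℚᵘP.≃-Reasoning

half-- : ∀ a b → half (a ℤ.- b) ≡ half a ℚ.- half b
half-- a b = trans (half-+ a (ℤ.- b)) (cong (half a ℚ.+_) (half-neg b))

half-mono-≤ : ∀ {a b} → a ℤ.≤ b → half a ℚ.≤ half b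
half-mono-≤ {a} {b} a≤b = ℚP.toℚᵘ-cancel-≤
  (ℚᵘP.≤-respʳ-≃ (ℚᵘP.≃-sym (toℚᵘ-half b)) (ℚᵘP.≤-respˡ-≃ (ℚᵘP.≃-sym (toℚᵘ-half a))
    (*≤* (ℤP.*-monoʳ-≤-nonNeg (+ 2) a≤b))))

half-cancel-≤ : ∀ {a b} → half a ℚ.≤ half b → a ℤ.≤ b
half-cancel-≤ {a} {b} le with ℚᵘP.≤-respʳ-≃ (toℚᵘ-half b) (ℚᵘP.≤-respˡ-≃ (toℚᵘ-half a) (ℚP.toℚᵘ-mono-≤ le))
... | *≤* a*2≤b*2 = ℤP.*-cancelʳ-≤-pos a b (+ 2) a*2≤b*2

half-mono-< : ∀ {a b} → a ℤ.< b → half a ℚ.< half b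
half-mono-< a<b = ℚP.≰⇒> (ℤP.<⇒≱ a<b ∘ half-cancel-≤)

half-cancel-< : ∀ {a b} → half a ℚ.< half b → a ℤ.< b
half-cancel-< lt = ℤP.≰⇒> (λ b≤a → ℚP.<-irrefl refl (ℚP.<-≤-trans lt (half-mono-≤ b≤a)))

half-injective : ∀ {a b} → half a ≡ half b → a ≡ b
half-injective eq = ℤP.≤-antisym (half-cancel-≤ (ℚP.≤-reflexive eq)) (half-cancel-≤ (ℚP.≤-reflexive (sym eq)))

half-≤⇔ : ∀ {a b} → (half a ℚ.≤ half b) ⇔ (a ℤ.≤ b)
half-≤⇔ = mk⇔ half-cancel-≤ half-mono-≤

half-<⇔ : ∀ {a b} → (half a ℚ.< half b) ⇔ (a ℤ.< b)
half-<⇔ = mk⇔ half-cancel-< half-mono-<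

≤-gap : ∀ {x y u v} → y ℤ.- x ≡ v ℤ.- u → x ℤ.≤ y → u ℤ.≤ v
≤-gap {x} {y} gap x≤y = ℤP.0≤i-j⇒j≤i (subst (ℤ.0ℤ ℤ.≤_) gap (ℤP.i≤j⇒0≤j-i x≤y))

<-gap : ∀ {x y u v} → y ℤ.- x ≡ v ℤ.- u → x ℤ.< y → u ℤ.< v
<-gap {x} {y} {u} {v} gap x<y = ℤP.suc[i]≤j⇒i<j (≤-gap (shifted x y u v gap) (ℤP.i<j⇒suc[i]≤j x<y))
  where
  shifted : ∀ x y u v → y ℤ.- x ≡ v ℤ.- u → y ℤ.- (ℤ.1ℤ ℤ.+ x) ≡ v ℤ.- (ℤ.1ℤ ℤ.+ u)
  shifted x y u v gap = trans (lower y x) (trans (cong (ℤ._- ℤ.1ℤ) gap) (sym (lower v u)))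
    where
    lower : ∀ y x → y ℤ.- (ℤ.1ℤ ℤ.+ x) ≡ y ℤ.- x ℤ.- ℤ.1ℤ
    lower = solve-∀

≤-gap⇔ : ∀ {x y u v} → y ℤ.- x ≡ v ℤ.- u → (x ℤ.≤ y) ⇔ (u ℤ.≤ v)
≤-gap⇔ gap = mk⇔ (≤-gap gap) (≤-gap (sym gap))

<-gap⇔ : ∀ {x y u v} → y ℤ.- x ≡ v ℤ.- u → (x ℤ.< y) ⇔ (u ℤ.< v)
<-gap⇔ gap = mk⇔ (<-gap gap) (<-gap (sym gap))

*2-≤⇔ : ∀ {x y} → (x ℤ.* + 2 ℤ.≤ y ℤ.* + 2) ⇔ (x ℤ.≤ y)
*2-≤⇔ {x} {y} = mk⇔ (ℤP.*-cancelʳ-≤-pos x y (+ 2)) (ℤP.*-monoʳ-≤-nonNeg (+ 2))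

suc-≤⇔ : ∀ {x y} → (ℤ.suc x ℤ.≤ y) ⇔ (x ℤ.< y)
suc-≤⇔ = mk⇔ ℤP.suc[i]≤j⇒i<j ℤP.i<j⇒suc[i]≤j

window⇔ : ∀ A e₀ →
  (ℚ.- half (e₀ ℤ.* + 2 ℤ.- A) ℚ.+ 1ℚ ℚ.≤ half A × half A ℚ.≤ half (e₀ ℤ.* + 2 ℤ.- A) ℚ.- 1ℚ)
  ⇔ (ℤ.0ℤ ℤ.< e₀ × A ℤ.< e₀)
window⇔ A e₀ = lower ×-⇔ upper
  where
  open import Relation.Binary.Reasoning.Setoid (⇔-setoid 0ℓ)
  p₂ = e₀ ℤ.* + 2 ℤ.- A
  lower-gap : ∀ A e₀ → A ℤ.- (ℤ.- (e₀ ℤ.* + 2 ℤ.- A) ℤ.+ + 2) ≡ e₀ ℤ.* + 2 ℤ.- + 1 ℤ.* + 2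
  lower-gap = solve-∀
  upper-gap : ∀ A e₀ → e₀ ℤ.* + 2 ℤ.- A ℤ.- + 2 ℤ.- A ≡ e₀ ℤ.* + 2 ℤ.- (ℤ.1ℤ ℤ.+ A) ℤ.* + 2
  upper-gap = solve-∀
  lower = begin
    (ℚ.- half p₂ ℚ.+ 1ℚ ℚ.≤ half A)          ≡⟨ cong (λ q → q ℚ.+ 1ℚ ℚ.≤ half A) (half-neg p₂) ⟨
    (half (ℤ.- p₂) ℚ.+ half (+ 2) ℚ.≤ half A) ≡⟨ cong (ℚ._≤ half A) (half-+ (ℤ.- p₂) (+ 2)) ⟨
    (half (ℤ.- p₂ ℤ.+ + 2) ℚ.≤ half A)       ≈⟨ half-≤⇔ ⟩
    (ℤ.- p₂ ℤ.+ + 2 ℤ.≤ A)                   ≈⟨ ≤-gap⇔ (lower-gap A e₀) ⟩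
    (+ 1 ℤ.* + 2 ℤ.≤ e₀ ℤ.* + 2)            ≈⟨ *2-≤⇔ ⟩
    (+ 1 ℤ.≤ e₀)                            ≈⟨ suc-≤⇔ ⟩
    (ℤ.0ℤ ℤ.< e₀)                           ∎
  upper = begin
    (half A ℚ.≤ half p₂ ℚ.- 1ℚ)              ≡⟨ cong (half A ℚ.≤_) (half-- p₂ (+ 2)) ⟨
    (half A ℚ.≤ half (p₂ ℤ.- + 2))           ≈⟨ half-≤⇔ ⟩
    (A ℤ.≤ p₂ ℤ.- + 2)                       ≈⟨ ≤-gap⇔ (upper-gap A e₀) ⟩
    ((ℤ.1ℤ ℤ.+ A) ℤ.* + 2 ℤ.≤ e₀ ℤ.* + 2)   ≈⟨ *2-≤⇔ ⟩
    (ℤ.suc A ℤ.≤ e₀)                        ≈⟨ suc-≤⇔ ⟩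
    (A ℤ.< e₀)                              ∎

-- Counting

open CommutativeMonoidSum ℕP.+-0-commutativeMonoid using (sum; sum-permute; ∑-comm; ∑-distrib-+; sum-cong-≗)

private
  variable
    ℓ ℓ′ : Level
    P : Set ℓ
    Q : Set ℓ′

𝟙 : Dec P → ℕ
𝟙 P? = if does P? then 1 else 0

𝟙-yes : (P? : Dec P) → P → 𝟙 P? ≡ 1
𝟙-yes (yes _) _ = refl
𝟙-yes (no ¬p) p = contradiction p ¬p

𝟙-no : (P? : Dec P) → ¬ P → 𝟙 P? ≡ 0
𝟙-no (yes p) ¬p = contradiction p ¬p
𝟙-no (no _)  _  = refl

𝟙≤1 : (P? : Dec P) → 𝟙 P? ℕ.≤ 1
𝟙≤1 (yes _) = ℕP.≤-refl
𝟙≤1 (no _)  = z≤n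

𝟙-mono : (P? : Dec P) (Q? : Dec Q) → (P → Q) → 𝟙 P? ℕ.≤ 𝟙 Q?
𝟙-mono (yes p) Q? P⇒Q = ℕP.≤-reflexive (sym (𝟙-yes Q? (P⇒Q p)))
𝟙-mono (no _)  _  _   = z≤n

𝟙-cong : (P? : Dec P) (Q? : Dec Q) → (P → Q) → (Q → P) → 𝟙 P? ≡ 𝟙 Q?
𝟙-cong P? Q? P⇒Q Q⇒P = ℕP.≤-antisym (𝟙-mono P? Q? P⇒Q) (𝟙-mono Q? P? Q⇒P)

𝟙-strict : (P? : Dec P) (Q? : Dec Q) → ¬ P → Q → 𝟙 P? ℕ.< 𝟙 Q?
𝟙-strict P? Q? ¬p q rewrite 𝟙-no P? ¬p | 𝟙-yes Q? q = ℕP.0<1+n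

𝟙-excluded : (P? : Dec P) (Q? : Dec Q) → (P → ¬ Q) → (¬ P → Q) → 𝟙 P? ℕ.+ 𝟙 Q? ≡ 1
𝟙-excluded (yes p) Q? P⇒¬Q _ = cong suc (𝟙-no Q? (P⇒¬Q p))
𝟙-excluded (no ¬p) Q? _ ¬P⇒Q = 𝟙-yes Q? (¬P⇒Q ¬p)

sum-mono : ∀ {m} {f g : Fin m → ℕ} → (∀ i → f i ℕ.≤ g i) → sum f ℕ.≤ sum g
sum-mono {zero}  f≤g = z≤n
sum-mono {suc m} f≤g = ℕP.+-mono-≤ (f≤g Fin.zero) (sum-mono (f≤g ∘ Fin.suc))

sum-strict : ∀ {m} {f g : Fin m → ℕ} → (∀ i → f i ℕ.≤ g i) → ∀ k → f k ℕ.< g k → sum f ℕ.< sum g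
sum-strict {suc m} f≤g Fin.zero    lt = ℕP.+-mono-<-≤ lt (sum-mono (f≤g ∘ Fin.suc))
sum-strict {suc m} f≤g (Fin.suc k) lt = ℕP.+-mono-≤-< (f≤g Fin.zero) (sum-strict (f≤g ∘ Fin.suc) k lt)

sum-const : ∀ m c → sum {m} (λ _ → c) ≡ m ℕ.* c
sum-const zero    c = refl
sum-const (suc m) c = cong (c ℕ.+_) (sum-const m c)

sum-zero : ∀ {m} {f : Fin m → ℕ} → (∀ k → f k ≡ 0) → sum f ≡ 0
sum-zero {m} f≡0 = trans (sum-cong-≗ f≡0) (trans (sum-const m 0) (ℕP.*-zeroʳ m))

sum-↑ : ∀ m n (f : Fin (m ℕ.+ n) → ℕ) → sum f ≡ sum {m} (f ∘ (_↑ˡ n)) ℕ.+ sum {n} (f ∘ (m ↑ʳ_))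
sum-↑ zero    n f = refl
sum-↑ (suc m) n f = trans (cong (f Fin.zero ℕ.+_) (sum-↑ m n (f ∘ Fin.suc)))
                          (sym (ℕP.+-assoc (f Fin.zero) _ _))

Σ₂ : ∀ {m n} → (Fin m → Fin n → ℕ) → ℕ
Σ₂ f = sum (λ i → sum (f i))

Σ₂-cong : ∀ {m n} {f g : Fin m → Fin n → ℕ} → (∀ i j → f i j ≡ g i j) → Σ₂ f ≡ Σ₂ g
Σ₂-cong f≡g = sum-cong-≗ (λ i → sum-cong-≗ (f≡g i))

Σ₂-strict : ∀ {m n} {f g : Fin m → Fin n → ℕ} → (∀ i j → f i j ℕ.≤ g i j) →
            ∀ i j → f i j ℕ.< g i j → Σ₂ f ℕ.< Σ₂ g
Σ₂-strict f≤g i j lt = sum-strict (λ i → sum-mono (f≤g i)) i (sum-strict (f≤g i) j lt)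

Σ₂-distrib-+ : ∀ {m n} (f g : Fin m → Fin n → ℕ) → Σ₂ (λ i j → f i j ℕ.+ g i j) ≡ Σ₂ f ℕ.+ Σ₂ g
Σ₂-distrib-+ f g = trans (sum-cong-≗ (λ i → ∑-distrib-+ (f i) (g i))) (∑-distrib-+ (λ i → sum (f i)) (λ i → sum (g i)))

Σ₂-permute : ∀ {m n} (f : Fin m → Fin n → ℕ) (π : Permutation′ m) (σ : Permutation′ n) →
             Σ₂ f ≡ Σ₂ (λ i j → f (π ⟨$⟩ʳ i) (σ ⟨$⟩ʳ j))
Σ₂-permute f π σ = trans (sum-permute (λ i → sum (f i)) π) (sum-cong-≗ (λ i → sum-permute (f (π ⟨$⟩ʳ i)) σ))

module _ {a p} {A : Set a} {P : Pred A p} (P? : Decidable P) where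

  length-filter-tabulate : ∀ {m} (f : Fin m → A) → length (filter P? (tabulate f)) ≡ sum (𝟙 ∘ P? ∘ f)
  length-filter-tabulate {zero}  f = refl
  length-filter-tabulate {suc m} f with does (P? (f Fin.zero))
  ... | true  = cong suc (length-filter-tabulate (f ∘ Fin.suc))
  ... | false = length-filter-tabulate (f ∘ Fin.suc)

  length-filter-++ : ∀ xs ys → length (filter P? (xs List.++ ys)) ≡ length (filter P? xs) ℕ.+ length (filter P? ys)
  length-filter-++ xs ys = trans (cong length (ListP.filter-++ P? xs ys)) (ListP.length-++ (filter P? xs))

length-filter-cartesianProduct : ∀ {a b p} {A : Set a} {B : Set b} {P : Pred (A × B) p} (P? : Decidable P)
  {m n} (f : Fin m → A) (g : Fin n → B) →
  length (filter P? (cartesianProduct (tabulate f) (tabulate g))) ≡ Σ₂ (λ i j → 𝟙 (P? (f i , g j)))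
length-filter-cartesianProduct P? {zero}  f g = refl
length-filter-cartesianProduct P? {suc m} f g = begin
  length (filter P? (map (f Fin.zero ,_) (tabulate g) List.++ cartesianProduct (tabulate (f ∘ Fin.suc)) (tabulate g)))
    ≡⟨ length-filter-++ P? (map (f Fin.zero ,_) (tabulate g)) _ ⟩
  length (filter P? (map (f Fin.zero ,_) (tabulate g))) ℕ.+ length (filter P? (cartesianProduct (tabulate (f ∘ Fin.suc)) (tabulate g)))
    ≡⟨ cong₂ ℕ._+_ (trans (cong (length ∘ filter P?) (ListP.map-tabulate g (f Fin.zero ,_)))
                          (length-filter-tabulate P? ((f Fin.zero ,_) ∘ g)))
                   (length-filter-cartesianProduct P? (f ∘ Fin.suc) g) ⟩
  Σ₂ (λ i j → 𝟙 (P? (f i , g j))) ∎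
  where open ≡-Reasoning

-- Sorting permutations

StrictlyDecreasing : ∀ {m} → (Fin m → ℤ) → Set
StrictlyDecreasing X = ∀ a b → a Fin.< b → X b ℤ.< X a

StrictlyDecreasing⇒injective : ∀ {m} {X : Fin m → ℤ} → StrictlyDecreasing X → Injective _≡_ _≡_ X
StrictlyDecreasing⇒injective X↓ {a} {b} Xa≡Xb with FinP.<-cmp a b
... | tri< a<b _ _ = contradiction (sym Xa≡Xb) (ℤP.<⇒≢ (X↓ a b a<b))
... | tri≈ _ a≡b _ = a≡b
... | tri> _ _ b<a = contradiction Xa≡Xb (ℤP.<⇒≢ (X↓ b a b<a))

-- inversions with respect to the non-increasing order
inversions : ∀ {m} → (Fin m → ℤ) → ℕ
inversions X = Σ₂ (λ a b → 𝟙 ((b Fin.<? a) ×-dec (X b ℤ.<? X a)))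

SortedBy : ∀ {m} → Permutation′ m → (Fin m → ℤ) → Set
SortedBy w X = ∀ a b → (w ⟨$⟩ˡ a Fin.< w ⟨$⟩ˡ b) ⇔ (X b ℤ.< X a)

module _ {m} {w : Permutation′ m} {X : Fin m → ℤ} (sorted : SortedBy w X) where
  open Equivalence

  len≡inversions : len w ≡ inversions X
  len≡inversions = begin
    len w
      ≡⟨ length-filter-cartesianProduct inverted? id id ⟩
    Σ₂ (λ i j → 𝟙 (inverted? (i , j)))
      ≡⟨ Σ₂-permute _ (Perm.flip w) (Perm.flip w) ⟩
    Σ₂ (λ a b → 𝟙 (inverted? (w ⟨$⟩ˡ a , w ⟨$⟩ˡ b)))
      ≡⟨ Σ₂-cong (λ a b → 𝟙-cong (inverted? (w ⟨$⟩ˡ a , w ⟨$⟩ˡ b)) ((b Fin.<? a) ×-dec (X b ℤ.<? X a))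
           (λ (lt , wlt) → subst₂ Fin._<_ (Perm.inverseʳ w) (Perm.inverseʳ w) wlt , to (sorted a b) lt)
           (λ (lt , Xlt) → from (sorted a b) Xlt , subst₂ Fin._<_ (sym (Perm.inverseʳ w)) (sym (Perm.inverseʳ w)) lt)) ⟩
    inversions X ∎
    where
    open ≡-Reasoning
    inverted? = λ (ij : Fin m × Fin m) → (proj₁ ij Fin.<? proj₂ ij) ×-dec (w ⟨$⟩ʳ proj₂ ij Fin.<? w ⟨$⟩ʳ proj₁ ij)

  SortedBy⇒injective : Injective _≡_ _≡_ X
  SortedBy⇒injective {a} {b} Xa≡Xb =
    trans (sym (Perm.inverseʳ w)) (trans (cong (w ⟨$⟩ʳ_) va≡vb) (Perm.inverseʳ w))
    where
    va≡vb : w ⟨$⟩ˡ a ≡ w ⟨$⟩ˡ b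
    va≡vb with FinP.<-cmp (w ⟨$⟩ˡ a) (w ⟨$⟩ˡ b)
    ... | tri< lt _ _ = contradiction (to (sorted a b) lt) (ℤP.<-irrefl (sym Xa≡Xb))
    ... | tri≈ _ eq _ = eq
    ... | tri> _ _ gt = contradiction (to (sorted b a) gt) (ℤP.<-irrefl Xa≡Xb)

  SortedBy⇒StrictlyDecreasing : StrictlyDecreasing (X ∘ (w ⟨$⟩ʳ_))
  SortedBy⇒StrictlyDecreasing a b a<b =
    to (sorted (w ⟨$⟩ʳ a) (w ⟨$⟩ʳ b)) (subst₂ Fin._<_ (sym (Perm.inverseˡ w)) (sym (Perm.inverseˡ w)) a<b)

StrictlyDecreasing⇒SortedBy : ∀ {m} {w : Permutation′ m} {X Y : Fin m → ℤ} →
  StrictlyDecreasing Y → (∀ i → X i ≡ Y (w ⟨$⟩ˡ i)) → SortedBy w X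
StrictlyDecreasing⇒SortedBy {w = w} {X} {Y} Y↓ X≡Y∘w⁻¹ a b = mk⇔ sorted sorted⁻¹
  where
  sorted : w ⟨$⟩ˡ a Fin.< w ⟨$⟩ˡ b → X b ℤ.< X a
  sorted lt = subst₂ ℤ._<_ (sym (X≡Y∘w⁻¹ b)) (sym (X≡Y∘w⁻¹ a)) (Y↓ _ _ lt)
  sorted⁻¹ : X b ℤ.< X a → w ⟨$⟩ˡ a Fin.< w ⟨$⟩ˡ b
  sorted⁻¹ Xb<Xa with FinP.<-cmp (w ⟨$⟩ˡ a) (w ⟨$⟩ˡ b) | subst₂ ℤ._<_ (X≡Y∘w⁻¹ b) (X≡Y∘w⁻¹ a) Xb<Xa
  ... | tri< lt _ _ | _   = lt
  ... | tri≈ _ eq _ | Ylt = contradiction (cong Y eq) (ℤP.<⇒≢ Ylt ∘ sym)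
  ... | tri> _ _ gt | Ylt = contradiction (Y↓ _ _ gt) (ℤP.<-asym Ylt)

injective⇒surjective : ∀ {m} {f : Fin m → Fin m} → Injective _≡_ _≡_ f → ∀ k → ∃ λ a → f a ≡ k
injective⇒surjective {suc m} {f} f-injective k with FinP.any? (λ a → f a FinP.≟ k)
... | yes hit = hit
... | no miss = contradiction (FinP.injective⇒≤ punchOut∘f-injective) ℕP.1+n≰n
  where
  punchOut∘f : Fin (suc m) → Fin m
  punchOut∘f a = Fin.punchOut {i = k} {j = f a} (λ k≡fa → miss (a , sym k≡fa))
  punchOut∘f-injective : Injective _≡_ _≡_ punchOut∘f
  punchOut∘f-injective {a} {b} eq =
    f-injective (FinP.punchOut-injective {i = k} (λ k≡fa → miss (a , sym k≡fa)) (λ k≡fb → miss (b , sym k≡fb)) eq)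

injective⇒permutation : ∀ {m} (f : Fin m → Fin m) → Injective _≡_ _≡_ f →
                        Σ (Permutation′ m) λ w → ∀ a → w ⟨$⟩ˡ a ≡ f a
injective⇒permutation f f-injective =
  permutation preimage f (λ a → f-injective (proj₂ (surjective (f a)))) (proj₂ ∘ surjective) , λ _ → refl
  where
  surjective = injective⇒surjective f-injective
  preimage = proj₁ ∘ surjective

module Rank {m} (X : Fin m → ℤ) (X-injective : Injective _≡_ _≡_ X) where

  height : Fin m → ℕ
  height a = sum (λ c → 𝟙 (X a ℤ.<? X c))

  height<m : ∀ a → height a ℕ.< m
  height<m a = subst (height a ℕ.<_) (trans (sum-const m 1) (ℕP.*-identityʳ m))
    (sum-strict (λ c → 𝟙≤1 (X a ℤ.<? X c)) a (subst (ℕ._< 1) (sym (𝟙-no (X a ℤ.<? X a) (ℤP.<-irrefl refl))) ℕP.0<1+n))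

  height-strict : ∀ {a b} → X b ℤ.< X a → height a ℕ.< height b
  height-strict {a} {b} Xb<Xa = sum-strict (λ c → 𝟙-mono (X a ℤ.<? X c) (X b ℤ.<? X c) (ℤP.<-trans Xb<Xa)) a
    (𝟙-strict (X a ℤ.<? X a) (X b ℤ.<? X a) (ℤP.<-irrefl refl) Xb<Xa)

  rank : Fin m → Fin m
  rank a = fromℕ< (height<m a)

  rank-strict : ∀ {a b} → X b ℤ.< X a → rank a Fin.< rank b
  rank-strict {a} {b} Xb<Xa =
    subst₂ ℕ._<_ (sym (FinP.toℕ-fromℕ< (height<m a))) (sym (FinP.toℕ-fromℕ< (height<m b))) (height-strict Xb<Xa)

  rank-injective : Injective _≡_ _≡_ rank
  rank-injective {a} {b} eq with ℤP.<-cmp (X a) (X b)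
  ... | tri< lt _ _ = contradiction (sym eq) (FinP.<⇒≢ (rank-strict lt))
  ... | tri≈ _ eq′ _ = X-injective eq′
  ... | tri> _ _ gt = contradiction eq (FinP.<⇒≢ (rank-strict gt))

  sortingPermutation : Σ (Permutation′ m) λ w → SortedBy w X
  sortingPermutation = w , λ a b → mk⇔ (sorted a b) (λ Xb<Xa → subst₂ Fin._<_ (sym (w≡rank a)) (sym (w≡rank b)) (rank-strict Xb<Xa))
    where
    w = proj₁ (injective⇒permutation rank rank-injective)
    w≡rank = proj₂ (injective⇒permutation rank rank-injective)
    sorted : ∀ a b → w ⟨$⟩ˡ a Fin.< w ⟨$⟩ˡ b → X b ℤ.< X a
    sorted a b lt with ℤP.<-cmp (X b) (X a)
    ... | tri< Xb<Xa _ _ = Xb<Xa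
    ... | tri≈ _ eq _ = contradiction (cong (w ⟨$⟩ˡ_) (X-injective eq)) (FinP.<⇒≢ lt ∘ sym)
    ... | tri> _ _ Xa<Xb = contradiction (subst₂ Fin._<_ (sym (w≡rank b)) (sym (w≡rank a)) (rank-strict Xa<Xb)) (FinP.<-asym lt)

-- Dominant weights and ρ

-- v + ρ, up to the additive constant (m - 1)/2
plusρ : ∀ {m} → (Fin m → ℤ) → Fin m → ℤ
plusρ v k = v k ℤ.- + toℕ k

Dominant⇒StrictlyDecreasing : ∀ {m} {v : Fin m → ℤ} → Dominant v → StrictlyDecreasing (plusρ v)
Dominant⇒StrictlyDecreasing dom a b a<b = ℤP.+-mono-≤-< (dom a b (ℕP.<⇒≤ a<b)) (ℤP.neg-mono-< (ℤ.+<+ a<b))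

adjacent⇒Dominant : ∀ {m} {v : Fin m → ℤ} → (∀ b c → toℕ c ≡ suc (toℕ b) → v c ℤ.≤ v b) → Dominant v
adjacent⇒Dominant {m} {v} step i j i≤j = descend (toℕ j ℕ.∸ toℕ i) j (sym (ℕP.m∸n+n≡m i≤j))
  where
  descend : ∀ d c → toℕ c ≡ d ℕ.+ toℕ i → v c ℤ.≤ v i
  descend zero    c c≡i = ℤP.≤-reflexive (cong v (FinP.toℕ-injective c≡i))
  descend (suc d) c c≡1+d+i = ℤP.≤-trans (step b c c≡1+b) (descend d b (FinP.toℕ-fromℕ< b<m))
    where
    b<m : d ℕ.+ toℕ i ℕ.< m
    b<m = ℕP.<⇒≤ (subst (ℕ._< m) c≡1+d+i (FinP.toℕ<n c))
    b = fromℕ< b<m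
    c≡1+b : toℕ c ≡ suc (toℕ b)
    c≡1+b = trans c≡1+d+i (cong suc (sym (FinP.toℕ-fromℕ< b<m)))

StrictlyDecreasing⇒Dominant : ∀ {m} {Y : Fin m → ℤ} → StrictlyDecreasing Y → Dominant (λ k → Y k ℤ.+ + toℕ k)
StrictlyDecreasing⇒Dominant {Y = Y} Y↓ = adjacent⇒Dominant λ b c c≡1+b → begin
  Y c ℤ.+ + toℕ c          ≡⟨ cong (λ t → Y c ℤ.+ + t) c≡1+b ⟩
  Y c ℤ.+ (ℤ.1ℤ ℤ.+ + toℕ b) ≡⟨ shuffle (Y c) (+ toℕ b) ⟩
  ℤ.suc (Y c) ℤ.+ + toℕ b  ≤⟨ ℤP.+-monoˡ-≤ (+ toℕ b) (ℤP.i<j⇒suc[i]≤j (Y↓ b c (ℕP.≤-reflexive (sym c≡1+b)))) ⟩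
  Y b ℤ.+ + toℕ b          ∎
  where
  open ℤP.≤-Reasoning
  shuffle : ∀ y t → y ℤ.+ (ℤ.1ℤ ℤ.+ t) ≡ ℤ.1ℤ ℤ.+ y ℤ.+ t
  shuffle = solve-∀

ℤ→ℚ+ρ≡half : ∀ {N} a (k : Fin N) → ℤ→ℚ a ℚ.+ ρ N k ≡ half ((a ℤ.- + toℕ k) ℤ.* + 2 ℤ.+ (+ N ℤ.- ℤ.1ℤ))
ℤ→ℚ+ρ≡half {N} a k = begin
  ℤ→ℚ a ℚ.+ (half (+ suc N) ℚ.- ℤ→ℚ (+ suc (toℕ k)))
    ≡⟨ cong₂ (λ x y → x ℚ.+ (half (+ suc N) ℚ.- y)) (ℤ→ℚ≡half a) (ℤ→ℚ≡half (+ suc (toℕ k))) ⟩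
  half (a ℤ.* + 2) ℚ.+ (half (+ suc N) ℚ.- half (+ suc (toℕ k) ℤ.* + 2))
    ≡⟨ cong (half (a ℤ.* + 2) ℚ.+_) (half-- (+ suc N) (+ suc (toℕ k) ℤ.* + 2)) ⟨
  half (a ℤ.* + 2) ℚ.+ half (+ suc N ℤ.- + suc (toℕ k) ℤ.* + 2)
    ≡⟨ half-+ (a ℤ.* + 2) (+ suc N ℤ.- + suc (toℕ k) ℤ.* + 2) ⟨
  half (a ℤ.* + 2 ℤ.+ (+ suc N ℤ.- + suc (toℕ k) ℤ.* + 2))
    ≡⟨ cong half (regroup a (+ toℕ k) (+ N)) ⟩
  half ((a ℤ.- + toℕ k) ℤ.* + 2 ℤ.+ (+ N ℤ.- ℤ.1ℤ)) ∎
  where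
  open ≡-Reasoning
  regroup : ∀ a t n → a ℤ.* + 2 ℤ.+ ((ℤ.1ℤ ℤ.+ n) ℤ.- (ℤ.1ℤ ℤ.+ t) ℤ.* + 2) ≡ (a ℤ.- t) ℤ.* + 2 ℤ.+ (n ℤ.- ℤ.1ℤ)
  regroup = solve-∀

ℤ→ℚ+ρ-≡⇔ : ∀ {N} a b (k l : Fin N) → (ℤ→ℚ a ℚ.+ ρ N k ≡ ℤ→ℚ b ℚ.+ ρ N l) ⇔ (a ℤ.- + toℕ k ≡ b ℤ.- + toℕ l)
ℤ→ℚ+ρ-≡⇔ {N} a b k l = mk⇔
  (λ eq → ℤP.*-cancelʳ-≡ _ _ (+ 2) (+-cancelʳ (+ N ℤ.- ℤ.1ℤ) _ _
           (half-injective (trans (sym (ℤ→ℚ+ρ≡half a k)) (trans eq (ℤ→ℚ+ρ≡half b l))))))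
  (λ eq → trans (ℤ→ℚ+ρ≡half a k) (trans (cong (λ x → half (x ℤ.* + 2 ℤ.+ (+ N ℤ.- ℤ.1ℤ))) eq) (sym (ℤ→ℚ+ρ≡half b l))))

-- Vectors in two blocks

data Blocks (n : ℕ) {n′ : ℕ} : Fin (n ℕ.+ n′) → Set where
  left  : (i : Fin n)  → Blocks n (i ↑ˡ n′)
  right : (j : Fin n′) → Blocks n (n ↑ʳ j)

blocks : ∀ n {n′} (k : Fin (n ℕ.+ n′)) → Blocks n k
blocks n k with Fin.splitAt n k in eq
... | inj₁ i = subst (Blocks n) (FinP.splitAt⁻¹-↑ˡ eq) (left i)
... | inj₂ j = subst (Blocks n) (FinP.splitAt⁻¹-↑ʳ eq) (right j)

concatW-↑ˡ : ∀ {n n′} (u : Fin n → ℤ) (v : Fin n′ → ℤ) i → concatW u v (i ↑ˡ n′) ≡ u i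
concatW-↑ˡ {n} {n′} u v i with Fin.splitAt n (i ↑ˡ n′) | FinP.splitAt-↑ˡ n i n′
... | inj₁ _ | refl = refl

concatW-↑ʳ : ∀ {n n′} (u : Fin n → ℤ) (v : Fin n′ → ℤ) j → concatW u v (n ↑ʳ j) ≡ v j
concatW-↑ʳ {n} {n′} u v j with Fin.splitAt n (n ↑ʳ j) | FinP.splitAt-↑ʳ n n′ j
... | inj₂ _ | refl = refl

↑ˡ<↑ʳ : ∀ {n n′} (i : Fin n) (j : Fin n′) → i ↑ˡ n′ Fin.< n ↑ʳ j
↑ˡ<↑ʳ {n} {n′} i j = subst₂ ℕ._<_ (sym (FinP.toℕ-↑ˡ i n′)) (sym (FinP.toℕ-↑ʳ n j))
                              (ℕP.<-≤-trans (FinP.toℕ<n i) (ℕP.m≤m+n n (toℕ j)))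

toℕ-↑ˡ<n : ∀ {n} n′ (i : Fin n) → toℕ (i ↑ˡ n′) ℕ.< n
toℕ-↑ˡ<n n′ i = subst (ℕ._< _) (sym (FinP.toℕ-↑ˡ i n′)) (FinP.toℕ<n i)

n≤toℕ-↑ʳ : ∀ n {n′} (j : Fin n′) → n ℕ.≤ toℕ (n ↑ʳ j)
n≤toℕ-↑ʳ n j = subst (n ℕ.≤_) (sym (FinP.toℕ-↑ʳ n j)) (ℕP.m≤m+n n (toℕ j))

module TwoBlocks {n n′} {u : Fin n → ℤ} {v : Fin n′ → ℤ} (u↓ : StrictlyDecreasing u) (v↓ : StrictlyDecreasing v) where

  X : Fin (n ℕ.+ n′) → ℤ
  X = concatW u v

  decreasing-within-blocks : ∀ a b → a Fin.< b → toℕ b ℕ.< n ⊎ n ℕ.≤ toℕ a → X b ℤ.< X a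
  decreasing-within-blocks a b a<b same = within (blocks n a) (blocks n b) a<b same
    where
    within : ∀ {a b} → Blocks n a → Blocks n b → a Fin.< b → toℕ b ℕ.< n ⊎ n ℕ.≤ toℕ a → X b ℤ.< X a
    within (left i) (left i′) lt _ = subst₂ ℤ._<_ (sym (concatW-↑ˡ u v i′)) (sym (concatW-↑ˡ u v i))
      (u↓ i i′ (subst₂ ℕ._<_ (FinP.toℕ-↑ˡ i n′) (FinP.toℕ-↑ˡ i′ n′) lt))
    within (right j) (right j′) lt _ = subst₂ ℤ._<_ (sym (concatW-↑ʳ u v j′)) (sym (concatW-↑ʳ u v j))
      (v↓ j j′ (ℕP.+-cancelˡ-< n _ _ (subst₂ ℕ._<_ (FinP.toℕ-↑ʳ n j) (FinP.toℕ-↑ʳ n j′) lt)))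
    within (left i) (right j′) _ (inj₁ lt) =
      contradiction (subst (ℕ._< n) (FinP.toℕ-↑ʳ n j′) lt) (ℕP.m+n≮m n (toℕ j′))
    within (left i) (right j′) _ (inj₂ le) =
      contradiction (subst (n ℕ.≤_) (FinP.toℕ-↑ˡ i n′) le) (ℕP.<⇒≱ (FinP.toℕ<n i))
    within (right j) (left i′) lt _ = contradiction lt (FinP.<-asym (↑ˡ<↑ʳ i′ j))

  no-inversion-within-blocks : ∀ a b → toℕ a ℕ.< n ⊎ n ℕ.≤ toℕ b → 𝟙 ((b Fin.<? a) ×-dec (X b ℤ.<? X a)) ≡ 0
  no-inversion-within-blocks a b same = 𝟙-no ((b Fin.<? a) ×-dec (X b ℤ.<? X a))
    (λ (b<a , Xb<Xa) → ℤP.<-asym Xb<Xa (decreasing-within-blocks b a b<a same))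

  inversions-concatW : inversions X ≡ Σ₂ (λ i j → 𝟙 (u i ℤ.<? v j))
  inversions-concatW = begin
    inversions X
      ≡⟨ sum-↑ n n′ (λ a → sum (inversion a)) ⟩
    sum (λ i → sum (inversion (i ↑ˡ n′))) ℕ.+ sum (λ j → sum (inversion (n ↑ʳ j)))
      ≡⟨ cong₂ ℕ._+_ (sum-zero leftRow) (sum-cong-≗ rightRow) ⟩
    sum (λ j → sum (λ i → 𝟙 (u i ℤ.<? v j)))
      ≡⟨ ∑-comm (λ i j → 𝟙 (u i ℤ.<? v j)) ⟨
    Σ₂ (λ i j → 𝟙 (u i ℤ.<? v j)) ∎
    where
    open ≡-Reasoning
    inversion : Fin (n ℕ.+ n′) → Fin (n ℕ.+ n′) → ℕ
    inversion a b = 𝟙 ((b Fin.<? a) ×-dec (X b ℤ.<? X a))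
    leftRow : ∀ i → sum (inversion (i ↑ˡ n′)) ≡ 0
    leftRow i = sum-zero λ b → no-inversion-within-blocks (i ↑ˡ n′) b (inj₁ (toℕ-↑ˡ<n n′ i))
    rightRow : ∀ j → sum (inversion (n ↑ʳ j)) ≡ sum (λ i → 𝟙 (u i ℤ.<? v j))
    rightRow j = begin
      sum (inversion (n ↑ʳ j))
        ≡⟨ sum-↑ n n′ (inversion (n ↑ʳ j)) ⟩
      sum (λ i → inversion (n ↑ʳ j) (i ↑ˡ n′)) ℕ.+ sum (λ j′ → inversion (n ↑ʳ j) (n ↑ʳ j′))
        ≡⟨ cong₂ ℕ._+_ (sum-cong-≗ across) (sum-zero λ j′ → no-inversion-within-blocks (n ↑ʳ j) (n ↑ʳ j′) (inj₂ (n≤toℕ-↑ʳ n j′))) ⟩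
      sum (λ i → 𝟙 (u i ℤ.<? v j)) ℕ.+ 0
        ≡⟨ ℕP.+-identityʳ _ ⟩
      sum (λ i → 𝟙 (u i ℤ.<? v j)) ∎
      where
      across : ∀ i → inversion (n ↑ʳ j) (i ↑ˡ n′) ≡ 𝟙 (u i ℤ.<? v j)
      across i = 𝟙-cong ((i ↑ˡ n′ Fin.<? n ↑ʳ j) ×-dec (X (i ↑ˡ n′) ℤ.<? X (n ↑ʳ j))) (u i ℤ.<? v j)
        (λ (_ , lt) → subst₂ ℤ._<_ (concatW-↑ˡ u v i) (concatW-↑ʳ u v j) lt)
        (λ lt → ↑ˡ<↑ʳ i j , subst₂ ℤ._<_ (sym (concatW-↑ˡ u v i)) (sym (concatW-↑ʳ u v j)) lt)

  concatW-injective : (∀ i j → u i ≢ v j) → Injective _≡_ _≡_ X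
  concatW-injective u≢v {a} {b} = injective (blocks n a) (blocks n b)
    where
    injective : ∀ {a b} → Blocks n a → Blocks n b → X a ≡ X b → a ≡ b
    injective (left i) (left i′) eq = cong (_↑ˡ n′) (StrictlyDecreasing⇒injective u↓
      (trans (sym (concatW-↑ˡ u v i)) (trans eq (concatW-↑ˡ u v i′))))
    injective (right j) (right j′) eq = cong (n ↑ʳ_) (StrictlyDecreasing⇒injective v↓
      (trans (sym (concatW-↑ʳ u v j)) (trans eq (concatW-↑ʳ u v j′))))
    injective (left i) (right j) eq =
      contradiction (trans (sym (concatW-↑ˡ u v i)) (trans eq (concatW-↑ʳ u v j))) (u≢v i j)
    injective (right j) (left i) eq =
      contradiction (trans (sym (concatW-↑ˡ u v i)) (trans (sym eq) (concatW-↑ʳ u v j))) (u≢v i j)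

  separated : Injective _≡_ _≡_ X → ∀ i j → u i ≢ v j
  separated X-injective i j ui≡vj = FinP.<⇒≢ (↑ˡ<↑ʳ i j)
    (X-injective (trans (concatW-↑ˡ u v i) (trans ui≡vj (sym (concatW-↑ʳ u v j)))))

  SortedBy⇒InWP : ∀ {w} → SortedBy w X → InWP n w
  SortedBy⇒InWP sorted k 1+k<N 1+k≢n =
    Equivalence.from (sorted a b) (decreasing-within-blocks a b a<b same)
    where
    k<N = ℕP.<-trans (ℕP.n<1+n k) 1+k<N
    a = fromℕ< k<N
    b = fromℕ< 1+k<N
    a<b : a Fin.< b
    a<b = subst₂ ℕ._<_ (sym (FinP.toℕ-fromℕ< k<N)) (sym (FinP.toℕ-fromℕ< 1+k<N)) (ℕP.n<1+n k)
    same : toℕ b ℕ.< n ⊎ n ℕ.≤ toℕ a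
    same with ℕP.<-cmp (suc k) n
    ... | tri< lt _ _ = inj₁ (subst (ℕ._< n) (sym (FinP.toℕ-fromℕ< 1+k<N)) lt)
    ... | tri≈ _ eq _ = contradiction eq 1+k≢n
    ... | tri> _ _ gt = inj₂ (subst (n ℕ.≤_) (sym (FinP.toℕ-fromℕ< k<N)) (ℕP.≤-pred gt))

-- Symmetric weights

module ℤΣ = CommutativeMonoidSum ℤP.+-0-commutativeMonoid

get-toℕ : ∀ {m} (v : Fin m → ℤ) (k : Fin m) → get v (suc (toℕ k)) ≡ v k
get-toℕ {m} v k with toℕ k ℕ.<? m
... | yes k<m = cong v (FinP.fromℕ<-toℕ k k<m)
... | no k≮m  = contradiction (FinP.toℕ<n k) k≮m

sumℤ≡∑ : ∀ {m} (v : Fin m → ℤ) → sumℤ v ≡ ℤΣ.sum v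
sumℤ≡∑ v = foldr-map-tabulate id
  where
  foldr-map-tabulate : ∀ {j} (f : Fin j → Fin _) → List.foldr ℤ._+_ ℤ.0ℤ (map v (tabulate f)) ≡ ℤΣ.sum (v ∘ f)
  foldr-map-tabulate {zero}  f = refl
  foldr-map-tabulate {suc j} f = cong (λ z → v (f Fin.zero) ℤ.+ z) (foldr-map-tabulate (f ∘ Fin.suc))

outerSum : ∀ {m} → (Fin m → ℤ) → ℤ
outerSum {m} v = get v 1 ℤ.+ get v m

module _ {m} {v : Fin m → ℤ} (symmetric : Symmetric v) where

  private
    -- bᵢ + b_{m+1−i}; the symmetry a_{m−i} = aᵢ says exactly that it does not depend on i
    mirrored : ℕ → ℤ
    mirrored i = get v i ℤ.+ get v (suc m ℕ.∸ i)

    mirrored-step : ∀ i → 1 ℕ.≤ i → i ℕ.< m → mirrored i ≡ mirrored (suc i)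
    mirrored-step i 1≤i i<m = begin
      get v i ℤ.+ get v (suc m ℕ.∸ i)        ≡⟨ cong (λ t → get v i ℤ.+ get v t) (ℕP.+-∸-assoc 1 (ℕP.<⇒≤ i<m)) ⟩
      get v i ℤ.+ get v (suc (m ℕ.∸ i))      ≡⟨ exchange (get v (m ℕ.∸ i)) (get v (suc (m ℕ.∸ i))) (get v i) (get v (suc i)) (symmetric i 1≤i i<m) ⟩
      get v (suc i) ℤ.+ get v (m ℕ.∸ i)      ∎
      where
      open ≡-Reasoning
      exchange : ∀ a b c d → a ℤ.- b ℤ.+ ℤ.1ℤ ≡ c ℤ.- d ℤ.+ ℤ.1ℤ → c ℤ.+ b ≡ d ℤ.+ a
      exchange a b c d eq = begin
        c ℤ.+ b                                   ≡⟨ unfold₁ b c d ⟩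
        (c ℤ.- d ℤ.+ ℤ.1ℤ) ℤ.+ d ℤ.+ b ℤ.- ℤ.1ℤ   ≡⟨ cong (λ z → z ℤ.+ d ℤ.+ b ℤ.- ℤ.1ℤ) eq ⟨
        (a ℤ.- b ℤ.+ ℤ.1ℤ) ℤ.+ d ℤ.+ b ℤ.- ℤ.1ℤ   ≡⟨ unfold₂ a b d ⟩
        d ℤ.+ a                                   ∎
        where
        unfold₁ : ∀ b c d → c ℤ.+ b ≡ (c ℤ.- d ℤ.+ ℤ.1ℤ) ℤ.+ d ℤ.+ b ℤ.- ℤ.1ℤ
        unfold₁ = solve-∀
        unfold₂ : ∀ a b d → (a ℤ.- b ℤ.+ ℤ.1ℤ) ℤ.+ d ℤ.+ b ℤ.- ℤ.1ℤ ≡ d ℤ.+ a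
        unfold₂ = solve-∀

    mirrored-const : ∀ i → 1 ℕ.≤ i → i ℕ.≤ m → mirrored i ≡ outerSum v
    mirrored-const (suc zero)    _ _    = refl
    mirrored-const (suc (suc i)) _ 2+i≤m =
      trans (sym (mirrored-step (suc i) (s≤s z≤n) 2+i≤m)) (mirrored-const (suc i) (s≤s z≤n) (ℕP.<⇒≤ 2+i≤m))

  Symmetric⇒+opposite : ∀ k → v k ℤ.+ v (opposite k) ≡ outerSum v
  Symmetric⇒+opposite k = begin
    v k ℤ.+ v (opposite k)
      ≡⟨ cong₂ ℤ._+_ (get-toℕ v k) (get-toℕ v (opposite k)) ⟨
    get v (suc (toℕ k)) ℤ.+ get v (suc (toℕ (opposite k)))
      ≡⟨ cong (λ t → get v (suc (toℕ k)) ℤ.+ get v t) (trans (cong suc (FinP.opposite-prop k)) (sym (ℕP.+-∸-assoc 1 (FinP.toℕ<n k)))) ⟩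
    mirrored (suc (toℕ k))
      ≡⟨ mirrored-const (suc (toℕ k)) (s≤s z≤n) (FinP.toℕ<n k) ⟩
    outerSum v ∎
    where open ≡-Reasoning

  Symmetric⇒sum : sumℤ v ℤ.* + 2 ≡ outerSum v ℤ.* + m
  Symmetric⇒sum = begin
    sumℤ v ℤ.* + 2                               ≡⟨ cong (ℤ._* + 2) (sumℤ≡∑ v) ⟩
    ℤΣ.sum v ℤ.* + 2                             ≡⟨ double (ℤΣ.sum v) ⟩
    ℤΣ.sum v ℤ.+ ℤΣ.sum v                        ≡⟨ cong (λ z → ℤΣ.sum v ℤ.+ z) (ℤΣ.sum-permute v Perm.reverse) ⟩
    ℤΣ.sum v ℤ.+ ℤΣ.sum (v ∘ opposite)           ≡⟨ ℤΣ.∑-distrib-+ v (v ∘ opposite) ⟨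
    ℤΣ.sum (λ k → v k ℤ.+ v (opposite k))        ≡⟨ ℤΣ.sum-cong-≗ Symmetric⇒+opposite ⟩
    ℤΣ.sum {m} (λ _ → outerSum v)                ≡⟨ ∑-const m (outerSum v) ⟩
    outerSum v ℤ.* + m                           ∎
    where
    open ≡-Reasoning
    double : ∀ s → s ℤ.* + 2 ≡ s ℤ.+ s
    double = solve-∀
    ∑-const : ∀ j c → ℤΣ.sum {j} (λ _ → c) ≡ c ℤ.* + j
    ∑-const zero    c = sym (ℤP.*-zeroʳ c)
    ∑-const (suc j) c = trans (cong (λ z → c ℤ.+ z) (∑-const j c)) (sym (ℤP.*-suc c (+ j)))

Symmetric⇒dval≡half : ∀ {m} {v : Fin (suc m) → ℤ} → Symmetric v → dval v ≡ half (outerSum v)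
Symmetric⇒dval≡half {m} {v} symmetric = /≡half (sumℤ v) (outerSum v) m (Symmetric⇒sum symmetric)

-- Values paired about a centre

module Pairing {n n′} (e : Fin n → Fin n′ → ℤ) (A : ℤ)
  (e-pair : ∀ i j → e i j ℤ.+ e (opposite i) (opposite j) ≡ A)
  (e-off-centre : ∀ i j → e i j ℤ.* + 2 ≢ A) where

  e-opposite : ∀ i j → e (opposite i) (opposite j) ≡ A ℤ.- e i j
  e-opposite i j = trans (cancel (e i j) (e (opposite i) (opposite j))) (cong (ℤ._- e i j) (e-pair i j))
    where
    cancel : ∀ x y → y ≡ x ℤ.+ y ℤ.- x
    cancel = solve-∀

  below⇒opposite-above : ∀ i j → e i j ℤ.* + 2 ℤ.< A → A ℤ.< e (opposite i) (opposite j) ℤ.* + 2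
  below⇒opposite-above i j below = subst (λ x → A ℤ.< x ℤ.* + 2) (sym (e-opposite i j))
    (<-gap (reflect (e i j) A) below)
    where
    reflect : ∀ e A → A ℤ.- e ℤ.* + 2 ≡ (A ℤ.- e) ℤ.* + 2 ℤ.- A
    reflect = solve-∀

  opposite-above⇒below : ∀ i j → A ℤ.< e (opposite i) (opposite j) ℤ.* + 2 → e i j ℤ.* + 2 ℤ.< A
  opposite-above⇒below i j above = <-gap (reflect (e i j) A)
    (subst (λ x → A ℤ.< x ℤ.* + 2) (e-opposite i j) above)
    where
    reflect : ∀ e A → (A ℤ.- e) ℤ.* + 2 ℤ.- A ≡ A ℤ.- e ℤ.* + 2
    reflect = solve-∀

  above below negative : ℕ
  above    = Σ₂ (λ i j → 𝟙 (A ℤ.<? e i j ℤ.* + 2))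
  below    = Σ₂ (λ i j → 𝟙 (e i j ℤ.* + 2 ℤ.<? A))
  negative = Σ₂ (λ i j → 𝟙 (e i j ℤ.<? ℤ.0ℤ))

  above≡below : above ≡ below
  above≡below = trans (Σ₂-permute (λ i j → 𝟙 (A ℤ.<? e i j ℤ.* + 2)) Perm.reverse Perm.reverse) (Σ₂-cong λ i j →
    𝟙-cong (A ℤ.<? e (opposite i) (opposite j) ℤ.* + 2) (e i j ℤ.* + 2 ℤ.<? A)
           (opposite-above⇒below i j) (below⇒opposite-above i j))

  above+below : above ℕ.+ below ≡ n ℕ.* n′
  above+below = begin
    above ℕ.+ below                   ≡⟨ Σ₂-distrib-+ (λ i j → 𝟙 (A ℤ.<? e i j ℤ.* + 2)) (λ i j → 𝟙 (e i j ℤ.* + 2 ℤ.<? A)) ⟨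
    Σ₂ (λ i j → 𝟙 (A ℤ.<? e i j ℤ.* + 2) ℕ.+ 𝟙 (e i j ℤ.* + 2 ℤ.<? A))
                                      ≡⟨ Σ₂-cong (λ i j → 𝟙-excluded (A ℤ.<? e i j ℤ.* + 2) (e i j ℤ.* + 2 ℤ.<? A) ℤP.<-asym (not-above i j)) ⟩
    Σ₂ {n} {n′} (λ _ _ → 1)           ≡⟨ sum-cong-≗ {n} (λ _ → trans (sum-const n′ 1) (ℕP.*-identityʳ n′)) ⟩
    sum {n} (λ _ → n′)                ≡⟨ sum-const n n′ ⟩
    n ℕ.* n′                          ∎
    where
    open ≡-Reasoning
    not-above : ∀ i j → ¬ A ℤ.< e i j ℤ.* + 2 → e i j ℤ.* + 2 ℤ.< A
    not-above i j ¬above = ℤP.≤∧≢⇒< (ℤP.≮⇒≥ ¬above) (e-off-centre i j)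

  2*below≡total : 2 ℕ.* below ≡ n ℕ.* n′
  2*below≡total = trans (cong (below ℕ.+_) (ℕP.+-identityʳ below))
                        (trans (cong (ℕ._+ below) (sym above≡below)) above+below)

  some-above : Fin n → Fin n′ → ∃ λ i → ∃ λ j → A ℤ.< e i j ℤ.* + 2
  some-above i j with ℤP.<-cmp A (e i j ℤ.* + 2)
  ... | tri< above _ _ = i , j , above
  ... | tri≈ _ eq _    = contradiction (sym eq) (e-off-centre i j)
  ... | tri> _ _ below = opposite i , opposite j , below⇒opposite-above i j below

  module Least (i₀ : Fin n) (j₀ : Fin n′) (above₀ : A ℤ.< e i₀ j₀ ℤ.* + 2)
               (least : ∀ i j → A ℤ.< e i j ℤ.* + 2 → e i₀ j₀ ℤ.≤ e i j) where

    e₀ : ℤ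
    e₀ = e i₀ j₀

    -- if e₀ exceeds 0 and A, the sign of e agrees with the side of A/2 it lies on
    signs-agree : ℤ.0ℤ ℤ.< e₀ → A ℤ.< e₀ → 2 ℕ.* negative ≡ n ℕ.* n′ × (∀ i j → e i j ≢ ℤ.0ℤ)
    signs-agree 0<e₀ A<e₀ = trans (cong (2 ℕ.*_) negative≡below) 2*below≡total , nonzero
      where
      positive : ∀ i j → A ℤ.< e i j ℤ.* + 2 → ℤ.0ℤ ℤ.< e i j
      positive i j above = ℤP.<-≤-trans 0<e₀ (least i j above)
      negative′ : ∀ i j → e i j ℤ.* + 2 ℤ.< A → e i j ℤ.< ℤ.0ℤ
      negative′ i j below = <-gap (flip-gap A (e i j))
        (ℤP.<-≤-trans A<e₀ (subst (e₀ ℤ.≤_) (e-opposite i j) (least _ _ (below⇒opposite-above i j below))))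
        where
        flip-gap : ∀ A e → A ℤ.- e ℤ.- A ≡ ℤ.0ℤ ℤ.- e
        flip-gap = solve-∀
      negative≡below : negative ≡ below
      negative≡below = Σ₂-cong λ i j → 𝟙-cong (e i j ℤ.<? ℤ.0ℤ) (e i j ℤ.* + 2 ℤ.<? A)
        (λ e<0 → ℤP.≤∧≢⇒< (ℤP.≮⇒≥ (λ above → ℤP.<-asym e<0 (positive i j above))) (e-off-centre i j))
        (negative′ i j)
      nonzero : ∀ i j → e i j ≢ ℤ.0ℤ
      nonzero i j e≡0 with ℤP.<-cmp A (e i j ℤ.* + 2)
      ... | tri< above _ _ = ℤP.<⇒≢ (positive i j above) (sym e≡0)
      ... | tri≈ _ eq _    = e-off-centre i j (sym eq)
      ... | tri> _ _ below = ℤP.<⇒≢ (negative′ i j below) e≡0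

    -- If e₀ ≤ 0 then A < 0, so every pair below the centre is negative; so is (i₀, j₀), which is above it.
    e₀-positive : negative ≡ below → (∀ i j → e i j ≢ ℤ.0ℤ) → ℤ.0ℤ ℤ.< e₀
    e₀-positive negative≡below nonzero with ℤ.0ℤ ℤ.<? e₀
    ... | yes 0<e₀ = 0<e₀
    ... | no  0≮e₀ = contradiction (Σ₂-strict below⊆negative i₀ j₀ strict) (ℕP.<-irrefl (sym negative≡below))
      where
      e₀<0 : e₀ ℤ.< ℤ.0ℤ
      e₀<0 = ℤP.≤∧≢⇒< (ℤP.≮⇒≥ 0≮e₀) (nonzero i₀ j₀)
      A<0 : A ℤ.< ℤ.0ℤ
      A<0 = ℤP.<-trans above₀ (ℤP.*-monoʳ-<-pos (+ 2) e₀<0)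
      below⊆negative : ∀ i j → 𝟙 (e i j ℤ.* + 2 ℤ.<? A) ℕ.≤ 𝟙 (e i j ℤ.<? ℤ.0ℤ)
      below⊆negative i j = 𝟙-mono (e i j ℤ.* + 2 ℤ.<? A) (e i j ℤ.<? ℤ.0ℤ)
        (λ below → ℤP.*-cancelʳ-<-nonNeg (+ 2) (ℤP.<-trans below A<0))
      strict : 𝟙 (e₀ ℤ.* + 2 ℤ.<? A) ℕ.< 𝟙 (e₀ ℤ.<? ℤ.0ℤ)
      strict = 𝟙-strict (e₀ ℤ.* + 2 ℤ.<? A) (e₀ ℤ.<? ℤ.0ℤ) (ℤP.<-asym above₀) e₀<0

    -- If e₀ ≤ A then 0 < A, so every negative pair lies below the centre; so does the positive pair opposite (i₀, j₀).
    e₀-above-A : negative ≡ below → (∀ i j → e i j ≢ ℤ.0ℤ) → A ℤ.< e₀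
    e₀-above-A negative≡below nonzero with A ℤ.<? e₀
    ... | yes A<e₀ = A<e₀
    ... | no  A≮e₀ = contradiction (Σ₂-strict negative⊆below (opposite i₀) (opposite j₀) strict) (ℕP.<-irrefl negative≡below)
      where
      e₀≤A : e₀ ℤ.≤ A
      e₀≤A = ℤP.≮⇒≥ A≮e₀
      0<A : ℤ.0ℤ ℤ.< A
      0<A = <-gap (double-gap A) (ℤP.<-≤-trans above₀ (ℤP.*-monoʳ-≤-nonNeg (+ 2) e₀≤A))
        where
        double-gap : ∀ A → A ℤ.* + 2 ℤ.- A ≡ A ℤ.- ℤ.0ℤ
        double-gap = solve-∀
      e′ = e (opposite i₀) (opposite j₀)
      0<e′ : ℤ.0ℤ ℤ.< e′
      0<e′ = ℤP.≤∧≢⇒< (subst (ℤ.0ℤ ℤ.≤_) (sym (e-opposite i₀ j₀)) (ℤP.i≤j⇒0≤j-i e₀≤A)) (nonzero _ _ ∘ sym)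
      negative⊆below : ∀ i j → 𝟙 (e i j ℤ.<? ℤ.0ℤ) ℕ.≤ 𝟙 (e i j ℤ.* + 2 ℤ.<? A)
      negative⊆below i j = 𝟙-mono (e i j ℤ.<? ℤ.0ℤ) (e i j ℤ.* + 2 ℤ.<? A)
        (λ e<0 → ℤP.<-trans (ℤP.*-monoʳ-<-pos (+ 2) e<0) 0<A)
      strict : 𝟙 (e′ ℤ.<? ℤ.0ℤ) ℕ.< 𝟙 (e′ ℤ.* + 2 ℤ.<? A)
      strict = 𝟙-strict (e′ ℤ.<? ℤ.0ℤ) (e′ ℤ.* + 2 ℤ.<? A) (ℤP.<-asym 0<e′)
        (opposite-above⇒below (opposite i₀) (opposite j₀)
          (subst₂ (λ i j → A ℤ.< e i j ℤ.* + 2) (sym (FinP.opposite-involutive i₀)) (sym (FinP.opposite-involutive j₀)) above₀))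

    signs-agree⁻¹ : 2 ℕ.* negative ≡ n ℕ.* n′ → (∀ i j → e i j ≢ ℤ.0ℤ) → ℤ.0ℤ ℤ.< e₀ × A ℤ.< e₀
    signs-agree⁻¹ 2*negative≡total nonzero = e₀-positive negative≡below nonzero , e₀-above-A negative≡below nonzero
      where
      negative≡below : negative ≡ below
      negative≡below = ℕP.*-cancelˡ-≡ negative below 2 (trans 2*negative≡total (sym 2*below≡total))

-- The least positive value of a list

foldr-⊓-∈ : ∀ x xs → List.foldr ℚ._⊓_ x xs ∈ x ∷ xs
foldr-⊓-∈ x []       = here refl
foldr-⊓-∈ x (y ∷ ys) with ℚP.⊓-sel y (List.foldr ℚ._⊓_ x ys)
... | inj₁ ⊓≡y = there (here ⊓≡y)
... | inj₂ ⊓≡m with foldr-⊓-∈ x ys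
...   | here m≡x  = here (trans ⊓≡m m≡x)
...   | there m∈ys = there (there (subst (_∈ ys) (sym ⊓≡m) m∈ys))

foldr-⊓-≤ : ∀ x xs {z} → z ∈ x ∷ xs → List.foldr ℚ._⊓_ x xs ℚ.≤ z
foldr-⊓-≤ x []       (here refl) = ℚP.≤-refl
foldr-⊓-≤ x (y ∷ ys) (there (here refl)) = ℚP.p⊓q≤p _ _
foldr-⊓-≤ x (y ∷ ys) (here refl)         = ℚP.≤-trans (ℚP.p⊓q≤q y _) (foldr-⊓-≤ x ys (here refl))
foldr-⊓-≤ x (y ∷ ys) (there (there z∈ys)) = ℚP.≤-trans (ℚP.p⊓q≤q y _) (foldr-⊓-≤ x ys (there z∈ys))

minimumℚ-∈ : ∀ {L z} → z ∈ L → minimumℚ L ∈ L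
minimumℚ-∈ {x ∷ xs} _ = foldr-⊓-∈ x xs

minimumℚ-≤ : ∀ {L z} → z ∈ L → minimumℚ L ℚ.≤ z
minimumℚ-≤ {x ∷ xs} = foldr-⊓-≤ x xs

least-positive : ∀ {a} {I : Set a} (f : I → ℚ) {xs : List I} {x} → x ∈ xs → 0ℚ ℚ.< f x →
  ∃ λ x₀ → minimumℚ (filter (0ℚ ℚP.<?_) (map f xs)) ≡ f x₀ × 0ℚ ℚ.< f x₀ ×
           (∀ {y} → y ∈ xs → 0ℚ ℚ.< f y → f x₀ ℚ.≤ f y)
least-positive f {xs} x∈xs 0<fx = x₀ , m≡fx₀ , subst (0ℚ ℚ.<_) m≡fx₀ 0<m , least
  where
  positives = filter (0ℚ ℚP.<?_) (map f xs)
  member : ∀ {y} → y ∈ xs → 0ℚ ℚ.< f y → f y ∈ positives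
  member y∈xs 0<fy = ∈P.∈-filter⁺ (0ℚ ℚP.<?_) (∈P.∈-map⁺ f y∈xs) 0<fy
  m∈ = minimumℚ-∈ (member x∈xs 0<fx)
  m∈map = proj₁ (∈P.∈-filter⁻ (0ℚ ℚP.<?_) {xs = map f xs} m∈)
  0<m = proj₂ (∈P.∈-filter⁻ (0ℚ ℚP.<?_) {xs = map f xs} m∈)
  x₀ = proj₁ (∈P.∈-map⁻ f m∈map)
  m≡fx₀ = proj₂ (proj₂ (∈P.∈-map⁻ f m∈map))
  least : ∀ {y} → y ∈ xs → 0ℚ ℚ.< f y → f x₀ ℚ.≤ f y
  least y∈xs 0<fy = subst (ℚ._≤ f _) m≡fx₀ (minimumℚ-≤ (member y∈xs 0<fy))

-- The weight μ̃ = (μ, μ′)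

β≡half : ∀ {m} .{{_ : ℕ.NonZero m}} {v : Fin m → ℤ} {c} → dval v ≡ half c →
         ∀ k → β v k ≡ half (plusρ v k ℤ.* + 2 ℤ.+ (+ m ℤ.- ℤ.1ℤ) ℤ.- c)
β≡half {m} {v = v} {c} dval≡ k = begin
  ℤ→ℚ (v k) ℚ.+ half (+ suc m) ℚ.- ℤ→ℚ (+ suc (toℕ k)) ℚ.- dval v
    ≡⟨ cong (ℚ._- dval v) (ℚP.+-assoc (ℤ→ℚ (v k)) (half (+ suc m)) (ℚ.- ℤ→ℚ (+ suc (toℕ k)))) ⟩
  ℤ→ℚ (v k) ℚ.+ ρ m k ℚ.- dval v
    ≡⟨ cong₂ ℚ._-_ (ℤ→ℚ+ρ≡half (v k) k) dval≡ ⟩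
  half (plusρ v k ℤ.* + 2 ℤ.+ (+ m ℤ.- ℤ.1ℤ)) ℚ.- half c
    ≡⟨ half-- (plusρ v k ℤ.* + 2 ℤ.+ (+ m ℤ.- ℤ.1ℤ)) c ⟨
  half (plusρ v k ℤ.* + 2 ℤ.+ (+ m ℤ.- ℤ.1ℤ) ℤ.- c) ∎
  where open ≡-Reasoning

plusρ-opposite : ∀ {m} {v : Fin m → ℤ} → Symmetric v →
                 ∀ k → plusρ v k ℤ.+ plusρ v (opposite k) ≡ outerSum v ℤ.- (+ m ℤ.- ℤ.1ℤ)
plusρ-opposite {m} {v} symmetric k = begin
  v k ℤ.- + toℕ k ℤ.+ (v (opposite k) ℤ.- + toℕ (opposite k))
    ≡⟨ regroup (v k) (v (opposite k)) (+ toℕ k) (+ toℕ (opposite k)) ⟩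
  (v k ℤ.+ v (opposite k)) ℤ.- ((+ toℕ k ℤ.+ + toℕ (opposite k) ℤ.+ ℤ.1ℤ) ℤ.- ℤ.1ℤ)
    ≡⟨ cong₂ (λ s t → s ℤ.- (+ t ℤ.- ℤ.1ℤ)) (Symmetric⇒+opposite symmetric k) indices ⟩
  outerSum v ℤ.- (+ m ℤ.- ℤ.1ℤ) ∎
  where
  open ≡-Reasoning
  regroup : ∀ a b s t → a ℤ.- s ℤ.+ (b ℤ.- t) ≡ (a ℤ.+ b) ℤ.- ((s ℤ.+ t ℤ.+ ℤ.1ℤ) ℤ.- ℤ.1ℤ)
  regroup = solve-∀
  indices : toℕ k ℕ.+ toℕ (opposite k) ℕ.+ 1 ≡ m
  indices = begin
    toℕ k ℕ.+ toℕ (opposite k) ℕ.+ 1   ≡⟨ ℕP.+-comm (toℕ k ℕ.+ _) 1 ⟩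
    suc (toℕ k ℕ.+ toℕ (opposite k))   ≡⟨ cong (λ t → suc (toℕ k ℕ.+ t)) (FinP.opposite-prop k) ⟩
    suc (toℕ k) ℕ.+ (m ℕ.∸ suc (toℕ k)) ≡⟨ ℕP.m+[n∸m]≡n (FinP.toℕ<n k) ⟩
    m                                  ∎

module Weights {n₀ n₁} (μ : Fin (suc n₀) → ℤ) (μ′ : Fin (suc n₁) → ℤ)
  (μ-dominant : Dominant μ) (μ′-dominant : Dominant μ′) (μ-symmetric : Symmetric μ) (μ′-symmetric : Symmetric μ′)
  (β+β′≢0 : ∀ i j → β μ i ℚ.+ β μ′ j ≢ 0ℚ) where

  n n′ : ℕ
  n  = suc n₀
  n′ = suc n₁

  x : Fin n → ℤ
  x = plusρ μ

  y : Fin n′ → ℤ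
  y j = plusρ μ′ j ℤ.- + n

  x↓ : StrictlyDecreasing x
  x↓ = Dominant⇒StrictlyDecreasing μ-dominant

  y↓ : StrictlyDecreasing y
  y↓ j j′ lt = ℤP.+-monoˡ-< (ℤ.- + n) (Dominant⇒StrictlyDecreasing μ′-dominant j j′ lt)

  open TwoBlocks x↓ y↓ public using (X)

  plusρ-concatW : ∀ k → plusρ (concatW μ μ′) k ≡ X k
  plusρ-concatW k = by-blocks (blocks n k)
    where
    by-blocks : ∀ {k} → Blocks n k → plusρ (concatW μ μ′) k ≡ X k
    by-blocks (left i) = begin
      concatW μ μ′ (i ↑ˡ n′) ℤ.- + toℕ (i ↑ˡ n′) ≡⟨ cong₂ (λ a t → a ℤ.- + t) (concatW-↑ˡ μ μ′ i) (FinP.toℕ-↑ˡ i n′) ⟩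
      x i                                       ≡⟨ concatW-↑ˡ x y i ⟨
      X (i ↑ˡ n′)                               ∎
      where open ≡-Reasoning
    by-blocks (right j) = begin
      concatW μ μ′ (n ↑ʳ j) ℤ.- + toℕ (n ↑ʳ j)  ≡⟨ cong₂ (λ a t → a ℤ.- + t) (concatW-↑ʳ μ μ′ j) (FinP.toℕ-↑ʳ n j) ⟩
      μ′ j ℤ.- (+ n ℤ.+ + toℕ j)                ≡⟨ regroup (μ′ j) (+ toℕ j) (+ n) ⟩
      y j                                       ≡⟨ concatW-↑ʳ x y j ⟨
      X (n ↑ʳ j)                                ∎
      where
      open ≡-Reasoning
      regroup : ∀ a t m → a ℤ.- (m ℤ.+ t) ≡ a ℤ.- t ℤ.- m
      regroup = solve-∀

  c c′ A : ℤ
  c  = outerSum μ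
  c′ = outerSum μ′
  A  = c ℤ.- c′ ℤ.+ + (n ℕ.+ n′)

  e : Fin n → Fin n′ → ℤ
  e i j = x i ℤ.- y (opposite j)

  e-pair : ∀ i j → e i j ℤ.+ e (opposite i) (opposite j) ≡ A
  e-pair i j = begin
    e i j ℤ.+ (x (opposite i) ℤ.- y (opposite (opposite j)))
      ≡⟨ cong (λ j′ → e i j ℤ.+ (x (opposite i) ℤ.- y j′)) (FinP.opposite-involutive j) ⟩
    x i ℤ.- (plusρ μ′ (opposite j) ℤ.- + n) ℤ.+ (x (opposite i) ℤ.- (plusρ μ′ j ℤ.- + n))
      ≡⟨ regroup (x i) (x (opposite i)) (plusρ μ′ j) (plusρ μ′ (opposite j)) (+ n) ⟩
    (x i ℤ.+ x (opposite i)) ℤ.- (plusρ μ′ j ℤ.+ plusρ μ′ (opposite j)) ℤ.+ (+ n ℤ.+ + n)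
      ≡⟨ cong₂ (λ s t → s ℤ.- t ℤ.+ (+ n ℤ.+ + n)) (plusρ-opposite μ-symmetric i) (plusρ-opposite μ′-symmetric j) ⟩
    (c ℤ.- (+ n ℤ.- ℤ.1ℤ)) ℤ.- (c′ ℤ.- (+ n′ ℤ.- ℤ.1ℤ)) ℤ.+ (+ n ℤ.+ + n)
      ≡⟨ simplify c c′ (+ n) (+ n′) ⟩
    A ∎
    where
    open ≡-Reasoning
    regroup : ∀ a a′ b b′ m → a ℤ.- (b′ ℤ.- m) ℤ.+ (a′ ℤ.- (b ℤ.- m)) ≡ (a ℤ.+ a′) ℤ.- (b ℤ.+ b′) ℤ.+ (m ℤ.+ m)
    regroup = solve-∀
    simplify : ∀ c c′ m m′ → (c ℤ.- (m ℤ.- ℤ.1ℤ)) ℤ.- (c′ ℤ.- (m′ ℤ.- ℤ.1ℤ)) ℤ.+ (m ℤ.+ m) ≡ c ℤ.- c′ ℤ.+ (m ℤ.+ m′)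
    simplify = solve-∀

  β+β′≡half : ∀ i j → β μ i ℚ.+ β μ′ j ≡ half (e i j ℤ.* + 2 ℤ.- A)
  β+β′≡half i j = begin
    β μ i ℚ.+ β μ′ j
      ≡⟨ cong₂ ℚ._+_ (β≡half {v = μ} (Symmetric⇒dval≡half μ-symmetric) i) (β≡half {v = μ′} (Symmetric⇒dval≡half μ′-symmetric) j) ⟩
    half (x i ℤ.* + 2 ℤ.+ (+ n ℤ.- ℤ.1ℤ) ℤ.- c) ℚ.+ half (plusρ μ′ j ℤ.* + 2 ℤ.+ (+ n′ ℤ.- ℤ.1ℤ) ℤ.- c′)
      ≡⟨ half-+ (x i ℤ.* + 2 ℤ.+ (+ n ℤ.- ℤ.1ℤ) ℤ.- c) (plusρ μ′ j ℤ.* + 2 ℤ.+ (+ n′ ℤ.- ℤ.1ℤ) ℤ.- c′) ⟨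
    half (x i ℤ.* + 2 ℤ.+ (+ n ℤ.- ℤ.1ℤ) ℤ.- c ℤ.+ (plusρ μ′ j ℤ.* + 2 ℤ.+ (+ n′ ℤ.- ℤ.1ℤ) ℤ.- c′))
      ≡⟨ cong half (regroup (x i) (plusρ μ′ j) (plusρ μ′ (opposite j)) c c′ (+ n) (+ n′) (plusρ-opposite μ′-symmetric j)) ⟩
    half (e i j ℤ.* + 2 ℤ.- A) ∎
    where
    open ≡-Reasoning
    regroup : ∀ a b b̄ c c′ m m′ → b ℤ.+ b̄ ≡ c′ ℤ.- (m′ ℤ.- ℤ.1ℤ) →
      a ℤ.* + 2 ℤ.+ (m ℤ.- ℤ.1ℤ) ℤ.- c ℤ.+ (b ℤ.* + 2 ℤ.+ (m′ ℤ.- ℤ.1ℤ) ℤ.- c′)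
        ≡ (a ℤ.- (b̄ ℤ.- m)) ℤ.* + 2 ℤ.- (c ℤ.- c′ ℤ.+ (m ℤ.+ m′))
    regroup a b b̄ c c′ m m′ eq = trans (expand a b c c′ m m′)
      (cong (λ t → (a ℤ.- (t ℤ.- m)) ℤ.* + 2 ℤ.- (c ℤ.- c′ ℤ.+ (m ℤ.+ m′))) (sym b̄≡))
      where
      expand : ∀ a b c c′ m m′ → a ℤ.* + 2 ℤ.+ (m ℤ.- ℤ.1ℤ) ℤ.- c ℤ.+ (b ℤ.* + 2 ℤ.+ (m′ ℤ.- ℤ.1ℤ) ℤ.- c′)
        ≡ (a ℤ.- ((c′ ℤ.- (m′ ℤ.- ℤ.1ℤ) ℤ.- b) ℤ.- m)) ℤ.* + 2 ℤ.- (c ℤ.- c′ ℤ.+ (m ℤ.+ m′))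
      expand = solve-∀
      cancel : ∀ b b̄ → b̄ ≡ b ℤ.+ b̄ ℤ.- b
      cancel = solve-∀
      b̄≡ : b̄ ≡ c′ ℤ.- (m′ ℤ.- ℤ.1ℤ) ℤ.- b
      b̄≡ = trans (cancel b b̄) (cong (ℤ._- b) eq)

  aTilde≡half : aTilde μ μ′ ≡ half A
  aTilde≡half = begin
    dval μ ℚ.- dval μ′ ℚ.+ half (+ (n ℕ.+ n′))
      ≡⟨ cong₂ (λ d d′ → d ℚ.- d′ ℚ.+ half (+ (n ℕ.+ n′))) (Symmetric⇒dval≡half {v = μ} μ-symmetric) (Symmetric⇒dval≡half {v = μ′} μ′-symmetric) ⟩
    half c ℚ.- half c′ ℚ.+ half (+ (n ℕ.+ n′))
      ≡⟨ cong (ℚ._+ half (+ (n ℕ.+ n′))) (half-- c c′) ⟨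
    half (c ℤ.- c′) ℚ.+ half (+ (n ℕ.+ n′))
      ≡⟨ half-+ (c ℤ.- c′) _ ⟨
    half A ∎
    where open ≡-Reasoning

  e≢0⇔separated : (∀ i j → e i j ≢ ℤ.0ℤ) ⇔ (∀ i j → x i ≢ y j)
  e≢0⇔separated = mk⇔
    (λ e≢0 i j xi≡yj → e≢0 i (opposite j)
      (trans (cong (λ j′ → x i ℤ.- y j′) (FinP.opposite-involutive j)) (ℤP.i≡j⇒i-j≡0 xi≡yj)))
    (λ separated i j e≡0 → separated i (opposite j) (ℤP.i-j≡0⇒i≡j _ _ e≡0))


  e-off-centre : ∀ i j → e i j ℤ.* + 2 ≢ A
  e-off-centre i j 2e≡A = β+β′≢0 i j (trans (β+β′≡half i j) (cong half (trans (cong (ℤ._- A) 2e≡A) (ℤP.+-inverseʳ A))))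

  open Pairing e A e-pair e-off-centre

  len≡negative : ∀ {w} → SortedBy w X → len w ≡ negative
  len≡negative {w} sorted = begin
    len w                                      ≡⟨ len≡inversions {m = n ℕ.+ n′} {w = w} {X = X} sorted ⟩
    inversions X                               ≡⟨ TwoBlocks.inversions-concatW x↓ y↓ ⟩
    Σ₂ (λ i j → 𝟙 (x i ℤ.<? y j))              ≡⟨ Σ₂-permute (λ i j → 𝟙 (x i ℤ.<? y j)) Perm.id Perm.reverse ⟩
    Σ₂ (λ i j → 𝟙 (x i ℤ.<? y (opposite j)))   ≡⟨ Σ₂-cong (λ i j → 𝟙-cong (x i ℤ.<? y (opposite j)) (e i j ℤ.<? ℤ.0ℤ)
                                                    (Equivalence.to (lt⇔ i j)) (Equivalence.from (lt⇔ i j))) ⟩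
    negative                                   ∎
    where
    open ≡-Reasoning
    lt⇔ : ∀ i j → (x i ℤ.< y (opposite j)) ⇔ (e i j ℤ.< ℤ.0ℤ)
    lt⇔ i j = <-gap⇔ (gap (x i) (y (opposite j)))
      where
      gap : ∀ a b → b ℤ.- a ≡ ℤ.0ℤ ℤ.- (a ℤ.- b)
      gap = solve-∀

  positive⇔above : ∀ i j → (0ℚ ℚ.< β μ i ℚ.+ β μ′ j) ⇔ (A ℤ.< e i j ℤ.* + 2)
  positive⇔above i j = begin
    (0ℚ ℚ.< β μ i ℚ.+ β μ′ j)           ≡⟨ cong (0ℚ ℚ.<_) (β+β′≡half i j) ⟩
    (half ℤ.0ℤ ℚ.< half (e i j ℤ.* + 2 ℤ.- A)) ≈⟨ half-<⇔ ⟩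
    (ℤ.0ℤ ℤ.< e i j ℤ.* + 2 ℤ.- A)      ≈⟨ <-gap⇔ (gap (e i j ℤ.* + 2) A) ⟩
    (A ℤ.< e i j ℤ.* + 2)               ∎
    where
    open import Relation.Binary.Reasoning.Setoid (⇔-setoid 0ℓ)
    gap : ∀ t A → t ℤ.- A ℤ.- ℤ.0ℤ ≡ t ℤ.- A
    gap = solve-∀

  ordered⇔ : ∀ i j i′ j′ → (β μ i ℚ.+ β μ′ j ℚ.≤ β μ i′ ℚ.+ β μ′ j′) ⇔ (e i j ℤ.≤ e i′ j′)
  ordered⇔ i j i′ j′ = begin
    (β μ i ℚ.+ β μ′ j ℚ.≤ β μ i′ ℚ.+ β μ′ j′)                   ≡⟨ cong₂ ℚ._≤_ (β+β′≡half i j) (β+β′≡half i′ j′) ⟩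
    (half (e i j ℤ.* + 2 ℤ.- A) ℚ.≤ half (e i′ j′ ℤ.* + 2 ℤ.- A)) ≈⟨ half-≤⇔ ⟩
    (e i j ℤ.* + 2 ℤ.- A ℤ.≤ e i′ j′ ℤ.* + 2 ℤ.- A)              ≈⟨ ≤-gap⇔ (gap (e i j ℤ.* + 2) (e i′ j′ ℤ.* + 2) A) ⟩
    (e i j ℤ.* + 2 ℤ.≤ e i′ j′ ℤ.* + 2)                           ≈⟨ *2-≤⇔ ⟩
    (e i j ℤ.≤ e i′ j′)                                           ∎
    where
    open import Relation.Binary.Reasoning.Setoid (⇔-setoid 0ℓ)
    gap : ∀ s t A → t ℤ.- A ℤ.- (s ℤ.- A) ≡ t ℤ.- s
    gap = solve-∀

  pairs : List (Fin n × Fin n′)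
  pairs = cartesianProduct (allFin n) (allFin n′)

  β+β′ : Fin n × Fin n′ → ℚ
  β+β′ ij = β μ (proj₁ ij) ℚ.+ β μ′ (proj₂ ij)

  ∈pairs : ∀ i j → (i , j) ∈ pairs
  ∈pairs i j = ∈P.∈-cartesianProduct⁺ (∈P.∈-allFin i) (∈P.∈-allFin j)

  p̃-attained : ∃ λ ij₀ → pTilde μ μ′ ≡ β+β′ ij₀ × 0ℚ ℚ.< β+β′ ij₀ ×
                        (∀ {ij} → ij ∈ pairs → 0ℚ ℚ.< β+β′ ij → β+β′ ij₀ ℚ.≤ β+β′ ij)
  p̃-attained = least-positive β+β′ (∈pairs i j) (Equivalence.from (positive⇔above i j) i,j-above)
    where
    i = proj₁ (some-above Fin.zero Fin.zero)
    j = proj₁ (proj₂ (some-above Fin.zero Fin.zero))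
    i,j-above = proj₂ (proj₂ (some-above Fin.zero Fin.zero))

  i₀ = proj₁ (proj₁ p̃-attained)
  j₀ = proj₂ (proj₁ p̃-attained)

  open Least i₀ j₀ (Equivalence.to (positive⇔above i₀ j₀) (proj₁ (proj₂ (proj₂ p̃-attained))))
    (λ i j i,j-above → Equivalence.to (ordered⇔ i₀ j₀ i j)
       (proj₂ (proj₂ (proj₂ p̃-attained)) (∈pairs i j) (Equivalence.from (positive⇔above i j) i,j-above)))

  p̃≡half : pTilde μ μ′ ≡ half (e₀ ℤ.* + 2 ℤ.- A)
  p̃≡half = trans (proj₁ (proj₂ p̃-attained)) (β+β′≡half i₀ j₀)

  window⇔e₀ : (ℚ.- pTilde μ μ′ ℚ.+ 1ℚ ℚ.≤ aTilde μ μ′ × aTilde μ μ′ ℚ.≤ pTilde μ μ′ ℚ.- 1ℚ)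
              ⇔ (ℤ.0ℤ ℤ.< e₀ × A ℤ.< e₀)
  window⇔e₀ = subst₂ (λ p a → (ℚ.- p ℚ.+ 1ℚ ℚ.≤ a × a ℚ.≤ p ℚ.- 1ℚ) ⇔ (ℤ.0ℤ ℤ.< e₀ × A ℤ.< e₀))
                     (sym p̃≡half) (sym aTilde≡half) (window⇔ A e₀)

  Realisable : Set
  Realisable = Σ (Permutation′ (n ℕ.+ n′)) (λ w → InWP n w × 2 ℕ.* len w ≡ n ℕ.* n′ ×
    Σ (Fin (n ℕ.+ n′) → ℤ) (λ lam → Dominant lam ×
      (∀ i → ℤ→ℚ (concatW μ μ′ i) ℚ.+ ρ (n ℕ.+ n′) i
           ≡ act w (λ k → ℤ→ℚ (lam k) ℚ.+ ρ (n ℕ.+ n′) k) i)))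

  realisable⇒e₀-bounds : Realisable → ℤ.0ℤ ℤ.< e₀ × A ℤ.< e₀
  realisable⇒e₀-bounds (w , _ , 2*len≡nn′ , lam , lam-dominant , μ̃+ρ≡w[λ+ρ]) =
    signs-agree⁻¹ (trans (cong (2 ℕ.*_) (sym (len≡negative {w} sorted))) 2*len≡nn′)
                  (Equivalence.from e≢0⇔separated (TwoBlocks.separated x↓ y↓ (SortedBy⇒injective {w = w} {X} sorted)))
    where
    sorted : SortedBy w X
    sorted = StrictlyDecreasing⇒SortedBy {w = w} {X} {plusρ lam} (Dominant⇒StrictlyDecreasing lam-dominant) λ i →
      trans (sym (plusρ-concatW i)) (Equivalence.to (ℤ→ℚ+ρ-≡⇔ (concatW μ μ′ i) (lam (w ⟨$⟩ˡ i)) i (w ⟨$⟩ˡ i)) (μ̃+ρ≡w[λ+ρ] i))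

  e₀-bounds⇒realisable : ℤ.0ℤ ℤ.< e₀ × A ℤ.< e₀ → Realisable
  e₀-bounds⇒realisable (0<e₀ , A<e₀) =
    w , TwoBlocks.SortedBy⇒InWP x↓ y↓ {w} sorted , trans (cong (2 ℕ.*_) (len≡negative {w} sorted)) 2*negative≡nn′ ,
    lam , StrictlyDecreasing⇒Dominant (SortedBy⇒StrictlyDecreasing {w = w} {X} sorted) , μ̃+ρ≡w[λ+ρ]
    where
    2*negative≡nn′ : 2 ℕ.* negative ≡ n ℕ.* n′
    2*negative≡nn′ = proj₁ (signs-agree 0<e₀ A<e₀)
    X-injective : Injective _≡_ _≡_ X
    X-injective = TwoBlocks.concatW-injective x↓ y↓ (Equivalence.to e≢0⇔separated (proj₂ (signs-agree 0<e₀ A<e₀)))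
    w : Permutation′ (n ℕ.+ n′)
    w = proj₁ (Rank.sortingPermutation X X-injective)
    sorted : SortedBy w X
    sorted = proj₂ (Rank.sortingPermutation X X-injective)
    lam : Fin (n ℕ.+ n′) → ℤ
    lam k = X (w ⟨$⟩ʳ k) ℤ.+ + toℕ k
    X≡plusρ-lam : ∀ i → X i ≡ plusρ lam (w ⟨$⟩ˡ i)
    X≡plusρ-lam i = sym (trans (cancel (X (w ⟨$⟩ʳ (w ⟨$⟩ˡ i))) (+ toℕ (w ⟨$⟩ˡ i))) (cong X (Perm.inverseʳ w {i})))
      where
      cancel : ∀ a t → a ℤ.+ t ℤ.- t ≡ a
      cancel = solve-∀
    μ̃+ρ≡w[λ+ρ] : ∀ i → ℤ→ℚ (concatW μ μ′ i) ℚ.+ ρ (n ℕ.+ n′) i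
                      ≡ act w (λ k → ℤ→ℚ (lam k) ℚ.+ ρ (n ℕ.+ n′) k) i
    μ̃+ρ≡w[λ+ρ] i = Equivalence.from (ℤ→ℚ+ρ-≡⇔ (concatW μ μ′ i) (lam (w ⟨$⟩ˡ i)) i (w ⟨$⟩ˡ i)) (trans (plusρ-concatW i) (X≡plusρ-lam i))

mainTheorem14 : (n n' : ℕ) .{{_ : NonZero n}} .{{_ : NonZero n'}} → 2 ∣ n →
  (μ : Fin n → ℤ) (μ' : Fin n' → ℤ) →
  Dominant μ → Dominant μ' → Symmetric μ → Symmetric μ' →
  (∀ (i : Fin n) (j : Fin n') → β μ i Data.Rational.+ β μ' j ≢ 0ℚ) →
  (Σ (Permutation′ (n + n')) (λ w → InWP n w × 2 * len w ≡ n * n' ×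
      Σ (Fin (n + n') → ℤ) (λ lam → Dominant lam ×
        (∀ i → ℤ→ℚ (concatW μ μ' i) Data.Rational.+ ρ (n + n') i
             ≡ act w (λ k → ℤ→ℚ (lam k) Data.Rational.+ ρ (n + n') k) i))))
  ⇔ ((- pTilde μ μ' Data.Rational.+ 1ℚ ≤ aTilde μ μ') × (aTilde μ μ' ≤ pTilde μ μ' - 1ℚ))
mainTheorem14 (suc n₀) (suc n₁) _ μ μ′ μ-dominant μ′-dominant μ-symmetric μ′-symmetric β+β′≢0 =
  mk⇔ (Equivalence.from window⇔e₀ ∘ realisable⇒e₀-bounds) (e₀-bounds⇒realisable ∘ Equivalence.to window⇔e₀)
  where open Weights μ μ′ μ-dominant μ′-dominant μ-symmetric μ′-symmetric β+β′≢0
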